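{- Let $k$ be a field and let $f \in k[x_1,\ldots,x_n]$ and $g \in k[y_1,\ldots,y_m]$ be polynomials vanishing at the origin. Then: (i) $\sigma(f+g) = \sigma(f) + \sigma(g)$; (ii) $\sigma(fg) = \min\{\sigma(f),\sigma(g)\}$; (iii) if $n \geq 2$, then $\sigma(f) \geq \sigma(f(x_1,\ldots,x_{n-1},x_{n-1}))$. Here $f+g$ and $fg$ are viewed in $k[x_1,\ldots,x_n,y_1,\ldots,y_m]$ and $f(x_1,\ldots,x_{n-1},x_{n-1})$ in $k[x_1,\ldots,x_{n-1}]$.
   Context: For a non-zero polynomial $h = \sum_i c_i u^i \in k[u_1,\ldots,u_N]$, $\Delta_0(h) = \mathrm{conv}\{i : c_i \neq 0\} + \mathbf{R}_{\geq 0}^N$, and $\sigma(h) \in (0,+\infty]$ is the supremum of the $\sigma>0$ such that $(1/\sigma,\ldots,1/\sigma) \in \Delta_0(h)$ (for $h$ non-zero with $h(0)=0$ this is the maximal such $\sigma$, a positive rational number). By convention $\sigma(0) = 0$. This value does not change when $h$ is regarded as a polynomial in additional variables. -}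

module Defs where

open import Level using (Level; _⊔_; suc)
open import Algebra.Bundles using (CommutativeRing)
open import Data.Nat as ℕ using (ℕ; zero)
import Data.Nat.Properties as ℕₚ
open import Data.Rational as ℚ using (ℚ; 0ℚ; 1ℚ; _/_)
open import Data.Rational.Properties using (pos⇒nonZero)
open import Data.Vec as Vec using (Vec; []; _∷_; replicate; _++_)
import Data.Vec.Properties as Vecₚ
open import Data.Fin using (Fin)
open import Data.List as List using (List; []; _∷_; concatMap)
open import Data.List.Relation.Unary.All using (All)
open import Data.Product using (Σ; _×_; _,_; proj₁; proj₂)
open import Data.Sum using (_⊎_)
open import Relation.Nullary using (¬_; yes; no)
open import Relation.Binary.PropositionalEquality using (_≡_)
open import Data.Vec.Relation.Binary.Pointwise.Inductive using (Pointwise)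
import Data.Integer as ℤ

record Field (c ℓ : Level) : Set (suc (c ⊔ ℓ)) where
  field
    commutativeRing : CommutativeRing c ℓ
  open CommutativeRing commutativeRing public
  field
    1≉0     : ¬ (1# ≈ 0#)
    inverse : ∀ x → ¬ (x ≈ 0#) → Σ Carrier λ y → (x * y) ≈ 1#

-- Polynomials in N variables over a field k, represented as finite
-- formal sums of terms  c · u^i  (c ∈ k, i ∈ ℕ^N).  The coefficient of
-- the monomial u^i is the sum of the c's of the terms with exponent i,
-- so like terms are combined and two representations with the same
-- coefficients denote the same polynomial.

module _ {c ℓ} (k : Field c ℓ) where
  open Field k

  Poly : ℕ → Set c
  Poly N = List (Carrier × Vec ℕ N)

  coeff : ∀ {N} → Poly N → Vec ℕ N → Carrier
  coeff []             i = 0#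
  coeff ((a , e) ∷ h) i with Vecₚ.≡-dec ℕₚ._≟_ e i
  ... | yes _ = a + coeff h i
  ... | no  _ = coeff h i

  IsZeroPoly : ∀ {N} → Poly N → Set ℓ
  IsZeroPoly {N} h = ∀ (i : Vec ℕ N) → coeff h i ≈ 0#

  VanishesAtOrigin : ∀ {N} → Poly N → Set ℓ
  VanishesAtOrigin {N} h = coeff h (replicate N 0) ≈ 0#

  _⊕_ : ∀ {N} → Poly N → Poly N → Poly N
  h ⊕ h' = h List.++ h'

  _⊗_ : ∀ {N} → Poly N → Poly N → Poly N
  h ⊗ h' = concatMap (λ { (a , e) → List.map (λ { (b , e') → (a * b , Vec.zipWith ℕ._+_ e e') }) h' }) h

  embedˣ : ∀ {n} m → Poly n → Poly (n ℕ.+ m)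
  embedˣ m = List.map λ { (a , e) → (a , e ++ replicate m 0) }

  embedʸ : ∀ n {m} → Poly m → Poly (n ℕ.+ m)
  embedʸ n = List.map λ { (a , e) → (a , replicate n 0 ++ e) }

  -- exponent of f(x₁,…,x_{n-1},x_{n-1}): merge the last two exponents
  mergeLast : ∀ {p} → Vec ℕ (ℕ.suc (ℕ.suc p)) → Vec ℕ (ℕ.suc p)
  mergeLast {zero}    (a ∷ b ∷ []) = (a ℕ.+ b) ∷ []
  mergeLast {ℕ.suc p} (a ∷ v)      = a ∷ mergeLast v

  substLast : ∀ {p} → Poly (ℕ.suc (ℕ.suc p)) → Poly (ℕ.suc p)
  substLast = List.map λ { (a , e) → (a , mergeLast e) }

-- Newton polyhedron Δ₀(h) = conv{ i : c_i ≠ 0 } + ℝ^N_{≥0}.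
-- Points with rational coordinates; a rational point lies in the
-- (rational) polyhedron iff it is ≥ (componentwise) a convex
-- combination of finitely many exponents in the support.

  toℚ : ∀ {N} → Vec ℕ N → Vec ℚ N
  toℚ = Vec.map (λ a → (ℤ.+ a) / 1)

  combination : ∀ {N} → List (ℚ × Vec ℕ N) → Vec ℚ N
  combination {N} = List.foldr (λ { (l , e) acc → Vec.zipWith ℚ._+_ (Vec.map (l ℚ.*_) (toℚ e)) acc })
                               (replicate N 0ℚ)

  InNewton : ∀ {N} → Poly N → Vec ℚ N → Set ℓ
  InNewton {N} h p =
    Σ (List (ℚ × Vec ℕ N)) λ L →
      All (λ t → (0ℚ ℚ.≤ proj₁ t) × ¬ (coeff h (proj₂ t) ≈ 0#)) L
      × List.foldr ℚ._+_ 0ℚ (List.map proj₁ L) ≡ 1ℚ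
      × Pointwise ℚ._≤_ (combination L) p

  Admissible : ∀ {N} → Poly N → ℚ → Set ℓ
  Admissible {N} h σ =
    Σ (0ℚ ℚ.< σ) λ pos →
      InNewton h (replicate N (ℚ.1/_ σ {{pos⇒nonZero σ {{ℚ.positive pos}}}}))

data ℚ∞ : Set where
  fin : ℚ → ℚ∞
  ∞   : ℚ∞

infix 4 _≤∞_
data _≤∞_ : ℚ∞ → ℚ∞ → Set where
  fin≤fin : ∀ {p q} → p ℚ.≤ q → fin p ≤∞ fin q
  _≤∞∞    : ∀ x → x ≤∞ ∞

infixl 6 _+∞_
_+∞_ : ℚ∞ → ℚ∞ → ℚ∞
fin p +∞ fin q = fin (p ℚ.+ q)
fin _ +∞ ∞     = ∞
∞     +∞ _     = ∞

min∞ : ℚ∞ → ℚ∞ → ℚ∞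
min∞ (fin p) (fin q) = fin (p ℚ.⊓ q)
min∞ (fin p) ∞       = fin p
min∞ ∞       y       = y

module _ {c ℓ} (k : Field c ℓ) where
  open Field k using (Carrier; _≈_; 0#)

  IsSup : (ℚ → Set ℓ) → ℚ∞ → Set ℓ
  IsSup S s = (∀ σ → S σ → fin σ ≤∞ s)
            × (∀ u → (∀ σ → S σ → fin σ ≤∞ u) → s ≤∞ u)

  IsSigma : ∀ {N} → Poly k N → ℚ∞ → Set ℓ
  IsSigma h s = (IsZeroPoly k h × s ≡ fin 0ℚ)
              ⊎ (¬ IsZeroPoly k h × IsSup (Admissible k h) s)

-- σ(h) is the supremum of A(h) = {s > 0 : (1/s,…,1/s) ∈ Δ₀(h)} ∪ {0}; including 0 makes the
-- convention σ(0) = 0 automatic. As f and g involve disjoint variables and vanish at the origin,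
-- supp(f + g) = supp f × {0} ∪ {0} × supp g, and as k is a field, supp(fg) = supp f × supp g.
-- A convex combination witnessing s ∈ A(f + g) splits into an f-part and a g-part of total
-- weights t and 1 − t, which rescale to witnesses of ts ∈ A(f) and (1 − t)s ∈ A(g); conversely,
-- witnesses of a ∈ A(f) and b ∈ A(g) mixed with weights a/(a+b) and b/(a+b) witness a + b.
-- So A(f + g) = A(f) + A(g). Projections of a witness for fg witness f and g, and the product
-- of witnesses for f and g at a common value witnesses fg; since A(h) ∖ {0} is closed downwards,
-- A(fg) = {min(a, b) : a ∈ A(f), b ∈ A(g)}. Each support point of f(x₁,…,x_{n−1},x_{n−1}) is
-- obtained from one of f by merging the last two exponents, which dominates every coordinate it
-- replaces, so A(f(x₁,…,x_{n−1},x_{n−1})) ⊆ A(f).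
-- Suprema of sums, of minima and of subsets then give (i)–(iii). Constructively, supports are
-- finite lists, so the existence statements needed hold under double negation, which the
-- decidable order on ℚ ∪ {+∞} absorbs.
module Submission where

open import Level using (Level)
open import Data.Nat as ℕ using (ℕ; zero; suc)
import Data.Nat.Properties as ℕₚ
import Data.Integer as ℤ
import Data.Integer.Properties as ℤₚ
open import Data.Nat.Divisibility using (∣1⇒≡1)
open import Data.Rational as ℚ using (ℚ; 0ℚ; 1ℚ; mkℚ)
open import Data.Rational.Solver using (module +-*-Solver)
open import Data.Fin as Fin using (Fin; _↑ˡ_; _↑ʳ_)
import Data.Fin.Properties as Finₚ
open import Data.Vec as Vec using (Vec; []; _∷_; replicate; _++_)
import Data.Vec.Properties as Vecₚ
import Data.Vec.Relation.Binary.Pointwise.Inductive as Pointwise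
open import Data.Vec.Relation.Binary.Pointwise.Extensional using (ext; extensional⇒inductive)
open import Data.List as List using (List; []; _∷_)
open import Data.List.Relation.Unary.All as All using (All; []; _∷_)
import Data.List.Relation.Unary.All.Properties as Allₚ
open import Data.List.Relation.Unary.Any using (here; there)
import Data.List.Properties as Listₚ
open import Function using (_∘_; id)
open import Function.Definitions using (Injective)
open import Data.List.Membership.Propositional using (_∈_)
open import Data.Product using (Σ; _×_; _,_; proj₁; proj₂; map₁; map₂)
import Data.Sum
open import Data.Sum using (_⊎_; inj₁; inj₂; [_,_]′)
open import Data.Empty using (⊥-elim)
open import Relation.Nullary using (¬_; Dec; yes; no; ¬?)
open import Relation.Nullary.Negation using (¬¬-Monad; contradiction)
open import Relation.Nullary.Decidable using (decidable-stable; ¬¬-excluded-middle)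
open import Relation.Binary.PropositionalEquality as ≡ using (_≡_; _≢_)

open import Algebra.Bundles using (CommutativeMonoid)
open import Defs

0ᵛ : ∀ n → Vec ℕ n
0ᵛ n = replicate n 0

module ExtendedRationals where

  open import Data.Rational using (_+_; _-_; _≤_; _<_; _⊓_)
  open import Data.Rational.Properties
  open +-*-Solver

  private
    variable
      x y u : ℚ∞

  infix 4 _≤∞?_
  _≤∞?_ : ∀ x y → Dec (x ≤∞ y)
  fin p ≤∞? fin q with p ℚ.≤? q
  ... | yes p≤q = yes (fin≤fin p≤q)
  ... | no p≰q = no λ { (fin≤fin p≤q) → p≰q p≤q }
  x ≤∞? ∞ = yes (x ≤∞∞)
  ∞ ≤∞? fin q = no λ ()

  ≤∞-refl : x ≤∞ x
  ≤∞-refl {fin p} = fin≤fin ≤-refl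
  ≤∞-refl {∞} = ∞ ≤∞∞

  ≤∞-trans : ∀ {x y z} → x ≤∞ y → y ≤∞ z → x ≤∞ z
  ≤∞-trans (fin≤fin p≤q) (fin≤fin q≤r) = fin≤fin (≤-trans p≤q q≤r)
  ≤∞-trans _ (_ ≤∞∞) = _ ≤∞∞

  ≤∞-antisym : x ≤∞ y → y ≤∞ x → x ≡ y
  ≤∞-antisym (fin≤fin p≤q) (fin≤fin q≤p) = ≡.cong fin (≤-antisym p≤q q≤p)
  ≤∞-antisym (∞ ≤∞∞) _ = ≡.refl

  fin≤fin⁻¹ : ∀ {p q} → fin p ≤∞ fin q → p ≤ q
  fin≤fin⁻¹ (fin≤fin p≤q) = p≤q

  ∞≰fin : ∀ {q} → ¬ (∞ ≤∞ fin q)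
  ∞≰fin ()

  +∞-mono : ∀ {a b} → fin a ≤∞ x → fin b ≤∞ y → fin (a + b) ≤∞ x +∞ y
  +∞-mono (fin≤fin a≤p) (fin≤fin b≤q) = fin≤fin (+-mono-≤ a≤p b≤q)
  +∞-mono {fin _} _ (_ ≤∞∞) = _ ≤∞∞
  +∞-mono {∞} _ _ = _ ≤∞∞

  min∞-glb : ∀ {s} → fin s ≤∞ x → fin s ≤∞ y → fin s ≤∞ min∞ x y
  min∞-glb (fin≤fin s≤p) (fin≤fin s≤q) = fin≤fin (⊓-glb s≤p s≤q)
  min∞-glb (fin≤fin s≤p) (_ ≤∞∞) = fin≤fin s≤p
  min∞-glb (_ ≤∞∞) s≤y = s≤y

  min∞-≤ˡ : x ≤∞ u → min∞ x y ≤∞ u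
  min∞-≤ˡ {y = fin q} (fin≤fin p≤r) = fin≤fin (p≤q⇒p⊓r≤q q p≤r)
  min∞-≤ˡ {fin _} {y = ∞} x≤u = x≤u
  min∞-≤ˡ {fin _} {y = fin _} (_ ≤∞∞) = _ ≤∞∞
  min∞-≤ˡ {∞} (_ ≤∞∞) = _ ≤∞∞

  min∞-≤ʳ : y ≤∞ u → min∞ x y ≤∞ u
  min∞-≤ʳ {x = fin p} (fin≤fin q≤r) = fin≤fin (p≤q⇒r⊓p≤q p q≤r)
  min∞-≤ʳ {x = ∞} y≤u = y≤u
  min∞-≤ʳ {x = fin _} (_ ≤∞∞) = _ ≤∞∞

  p+q≤r⇒p≤r-q : ∀ {p q r} → p + q ≤ r → p ≤ r - q
  p+q≤r⇒p≤r-q {p} {q} {r} p+q≤r =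
    ≡.subst (_≤ r - q) (solve 2 (λ p q → (p :+ q) :- q := p) ≡.refl p q) (+-monoˡ-≤ (ℚ.- q) p+q≤r)

  p≤r-q⇒p+q≤r : ∀ {p q r} → p ≤ r - q → p + q ≤ r
  p≤r-q⇒p+q≤r {p} {q} {r} p≤r-q =
    ≡.subst (p + q ≤_) (solve 2 (λ r q → (r :- q) :+ q := r) ≡.refl r q) (+-monoˡ-≤ q p≤r-q)

  UpperBound : ∀ {ℓ} → (ℚ → Set ℓ) → ℚ∞ → Set ℓ
  UpperBound S u = ∀ s → S s → fin s ≤∞ u

  IsLub : ∀ {ℓ} → (ℚ → Set ℓ) → ℚ∞ → Set ℓ
  IsLub S x = UpperBound S x × (∀ u → UpperBound S u → x ≤∞ u)

  private
    variable
      ℓ : Level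
      A B C : ℚ → Set ℓ

  lub-≤-fin : IsLub A x → ∀ {r} → (∀ a → A a → a ≤ r) → x ≤∞ fin r
  lub-≤-fin (_ , least) a≤r = least (fin _) λ a Aa → fin≤fin (a≤r a Aa)

  private
    lub-+-swap : ∀ {F b q} → IsLub A (fin F) → (∀ a → A a → a + b ≤ q) → b ≤ q - F
    lub-+-swap {F = F} {b} {q} A-lub a+b≤q = p+q≤r⇒p≤r-q (≡.subst (_≤ q) (+-comm F b)
      (p≤r-q⇒p+q≤r (fin≤fin⁻¹ (lub-≤-fin A-lub λ a Aa → p+q≤r⇒p≤r-q (a+b≤q a Aa)))))

  -- Any b₀ ∈ B bounds x by q − b₀, so x is finite; then every b ∈ B is at most q − x.
  lub-+-≤ : ∀ {q} → IsLub A x → IsLub B y → Σ ℚ B →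
            (∀ a b → A a → B b → a + b ≤ q) → x +∞ y ≤∞ fin q
  lub-+-≤ {x = ∞} A-lub _ (b₀ , Bb₀) a+b≤q =
    contradiction (lub-≤-fin A-lub λ a Aa → p+q≤r⇒p≤r-q (a+b≤q a b₀ Aa Bb₀)) ∞≰fin
  lub-+-≤ {x = fin F} {y = ∞} A-lub B-lub _ a+b≤q =
    contradiction (lub-≤-fin B-lub λ b Bb → lub-+-swap A-lub λ a Aa → a+b≤q a b Aa Bb) ∞≰fin
  lub-+-≤ {x = fin F} {y = fin G} {q = q} A-lub B-lub _ a+b≤q = fin≤fin (≡.subst (_≤ q) (+-comm G F)
    (p≤r-q⇒p+q≤r (fin≤fin⁻¹ (lub-≤-fin B-lub λ b Bb → lub-+-swap A-lub λ a Aa → a+b≤q a b Aa Bb))))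

  lub-+ : IsLub A x → IsLub B y → Σ ℚ B →
          (∀ s → C s → Σ ℚ λ a → Σ ℚ λ b → A a × B b × s ≡ a + b) →
          (∀ a b → A a → B b → C (a + b)) →
          IsLub C (x +∞ y)
  lub-+ {C = C} A-lub@(x-ub , _) B-lub@(y-ub , _) B-inhabited split sum = upper , least
    where
    upper : UpperBound C _
    upper s Cs = let (a , b , Aa , Bb , s≡a+b) = split s Cs in
      ≡.subst (λ t → fin t ≤∞ _) (≡.sym s≡a+b) (+∞-mono (x-ub a Aa) (y-ub b Bb))
    least : ∀ u → UpperBound C u → _ ≤∞ u
    least ∞ _ = _ ≤∞∞
    least (fin q) C≤q = lub-+-≤ A-lub B-lub B-inhabited λ a b Aa Bb → fin≤fin⁻¹ (C≤q _ (sum a b Aa Bb))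

  private
    ⊓-≤-< : ∀ {a b q} → a ⊓ b ≤ q → q < b → a ≤ q
    ⊓-≤-< {a} {b} a⊓b≤q q<b with ≤-total a b
    ... | inj₁ a≤b = ≡.subst (_≤ _) (p≤q⇒p⊓q≡p a≤b) a⊓b≤q
    ... | inj₂ b≤a = contradiction (<-≤-trans q<b (≡.subst (_≤ _) (p≥q⇒p⊓q≡q b≤a) a⊓b≤q)) (<-irrefl ≡.refl)

  lub-⊓ : IsLub A x → IsLub B y →
          (∀ s → C s → A s × B s) →
          (∀ a b → A a → B b → C (a ⊓ b)) →
          IsLub C (min∞ x y)
  lub-⊓ {B = B} {C = C} A-lub@(x-ub , _) B-lub@(y-ub , _) split min = upper , least
    where
    upper : UpperBound C _
    upper s Cs = min∞-glb (x-ub s (proj₁ (split s Cs))) (y-ub s (proj₂ (split s Cs)))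
    least : ∀ u → UpperBound C u → _ ≤∞ u
    least ∞ _ = _ ≤∞∞
    -- Whether some b ∈ B exceeds q is decided only under ¬ ¬, which the decidable goal absorbs.
    least (fin q) C≤q = decidable-stable (_ ≤∞? fin q) λ min≰q →
      ¬¬-excluded-middle {A = Σ ℚ λ b → B b × q < b} λ where
        (yes (b , Bb , q<b)) → min≰q (min∞-≤ˡ (lub-≤-fin A-lub λ a Aa →
                                 ⊓-≤-< (fin≤fin⁻¹ (C≤q _ (min a b Aa Bb))) q<b))
        (no ∄b) → min≰q (min∞-≤ʳ (lub-≤-fin B-lub λ b Bb → ≮⇒≥ λ q<b → ∄b (b , Bb , q<b)))

  lub-mono : (∀ s → A s → ¬ ¬ B s) → IsLub A x → IsLub B y → x ≤∞ y
  lub-mono {y = y} A⊆B (_ , x-least) (y-ub , _) =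
    x-least y λ s As → decidable-stable (fin s ≤∞? y) λ s≰y → A⊆B s As λ Bs → s≰y (y-ub s Bs)

module Reciprocals where

  open import Data.Rational using (_*_; _≤_; _<_)
  open import Data.Rational.Properties
  open +-*-Solver

  1/pos : (s : ℚ) → 0ℚ < s → ℚ
  1/pos s 0<s = ℚ.1/_ s {{pos⇒nonZero s {{ℚ.positive 0<s}}}}

  1/pos-pos : ∀ s 0<s → 0ℚ < 1/pos s 0<s
  1/pos-pos s 0<s = positive⁻¹ _ {{1/pos⇒pos s {{ℚ.positive 0<s}}}}

  *-1/pos : ∀ s 0<s → s * 1/pos s 0<s ≡ 1ℚ
  *-1/pos s 0<s = *-inverseʳ s {{pos⇒nonZero s {{ℚ.positive 0<s}}}}

  *-pos : ∀ {a b} → 0ℚ < a → 0ℚ < b → 0ℚ < a * b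
  *-pos {a} {b} 0<a 0<b = positive⁻¹ _ {{pos*pos⇒pos a {{ℚ.positive 0<a}} b {{ℚ.positive 0<b}}}}

  1/pos-unique : ∀ s 0<s y → s * y ≡ 1ℚ → y ≡ 1/pos s 0<s
  1/pos-unique s 0<s y sy≡1 = begin
    y                         ≡⟨ *-identityˡ y ⟨
    1ℚ * y                    ≡⟨ ≡.cong (_* y) (≡.trans (*-comm s⁻¹ s) (*-1/pos s 0<s)) ⟨
    s⁻¹ * s * y               ≡⟨ *-assoc s⁻¹ s y ⟩
    s⁻¹ * (s * y)             ≡⟨ ≡.cong (s⁻¹ *_) sy≡1 ⟩
    s⁻¹ * 1ℚ                  ≡⟨ *-identityʳ s⁻¹ ⟩
    s⁻¹                       ∎
    where
    open ≡.≡-Reasoning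
    s⁻¹ = 1/pos s 0<s

  1/pos-* : ∀ a 0<a b 0<b → 1/pos (a * b) (*-pos 0<a 0<b) ≡ 1/pos a 0<a * 1/pos b 0<b
  1/pos-* a 0<a b 0<b = ≡.sym (1/pos-unique (a * b) (*-pos 0<a 0<b) (1/pos a 0<a * 1/pos b 0<b) (begin
    a * b * (a⁻¹ * b⁻¹)   ≡⟨ solve 4 (λ a b x y → (a :* b) :* (x :* y) := (a :* x) :* (b :* y))
                                     ≡.refl a b a⁻¹ b⁻¹ ⟩
    a * a⁻¹ * (b * b⁻¹)   ≡⟨ ≡.cong₂ _*_ (*-1/pos a 0<a) (*-1/pos b 0<b) ⟩
    1ℚ * 1ℚ               ≡⟨ *-identityˡ 1ℚ ⟩
    1ℚ                    ∎))
    where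
    open ≡.≡-Reasoning
    a⁻¹ = 1/pos a 0<a
    b⁻¹ = 1/pos b 0<b

  1/pos-antimono-≤ : ∀ a 0<a b 0<b → a ≤ b → 1/pos b 0<b ≤ 1/pos a 0<a
  1/pos-antimono-≤ a 0<a b 0<b a≤b = begin
    b⁻¹               ≡⟨ *-identityʳ b⁻¹ ⟨
    b⁻¹ * 1ℚ          ≡⟨ ≡.cong (b⁻¹ *_) (*-1/pos a 0<a) ⟨
    b⁻¹ * (a * a⁻¹)   ≤⟨ *-monoˡ-≤-nonNeg b⁻¹ {{ℚ.nonNegative (<⇒≤ (1/pos-pos b 0<b))}}
                           (*-monoʳ-≤-nonNeg a⁻¹ {{ℚ.nonNegative (<⇒≤ (1/pos-pos a 0<a))}} a≤b) ⟩
    b⁻¹ * (b * a⁻¹)   ≡⟨ *-assoc b⁻¹ b a⁻¹ ⟨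
    b⁻¹ * b * a⁻¹     ≡⟨ ≡.cong (_* a⁻¹) (≡.trans (*-comm b⁻¹ b) (*-1/pos b 0<b)) ⟩
    1ℚ * a⁻¹          ≡⟨ *-identityˡ a⁻¹ ⟩
    a⁻¹               ∎
    where
    open ≤-Reasoning
    a⁻¹ = 1/pos a 0<a
    b⁻¹ = 1/pos b 0<b

module WeightedExponents where

  open import Data.Rational using (_+_; _*_; _≤_)
  open import Data.Rational.Properties
  open ≡.≡-Reasoning

  fromℕ : ℕ → ℚ
  fromℕ a = ℤ.+ a ℚ./ 1

  private
    fromℕ≡mkℚ : ∀ a → fromℕ a ≡ mkℚ (ℤ.+ a) 0 (λ p → ∣1⇒≡1 (proj₂ p))
    fromℕ≡mkℚ a = normalize-coprime {a} {0} (λ p → ∣1⇒≡1 (proj₂ p))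

  fromℕ-mono-≤ : ∀ {a b} → a ℕ.≤ b → fromℕ a ≤ fromℕ b
  fromℕ-mono-≤ {a} {b} a≤b rewrite fromℕ≡mkℚ a | fromℕ≡mkℚ b =
    ℚ.*≤* (≡.subst₂ ℤ._≤_ (≡.sym (ℤₚ.*-identityʳ (ℤ.+ a))) (≡.sym (ℤₚ.*-identityʳ (ℤ.+ b))) (ℤ.+≤+ a≤b))

  coord : ∀ {N} → Fin N → Vec ℕ N → ℚ
  coord i e = fromℕ (Vec.lookup e i)

  coord-0ᵛ : ∀ {N} (i : Fin N) → coord i (0ᵛ N) ≡ 0ℚ
  coord-0ᵛ i = ≡.cong fromℕ (Vecₚ.lookup-replicate i 0)

  CoordinatewiseMap : ∀ {N M} → (Vec ℕ N → Vec ℕ M) → Set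
  CoordinatewiseMap {N} {M} φ =
    ∀ (j : Fin M) → (Σ (Fin N) λ i → ∀ e → coord j (φ e) ≡ coord i e) ⊎ (∀ e → coord j (φ e) ≡ 0ℚ)

  Weighted : ℕ → Set
  Weighted N = List (ℚ × Vec ℕ N)

  NonNegWeights : ∀ {N} → Weighted N → Set
  NonNegWeights = All (λ t → 0ℚ ≤ proj₁ t)

  weightedSum : ∀ {N} → Weighted N → (Vec ℕ N → ℚ) → ℚ
  weightedSum [] w = 0ℚ
  weightedSum ((l , e) ∷ L) w = l * w e + weightedSum L w

  totalWeight : ∀ {N} → Weighted N → ℚ
  totalWeight L = weightedSum L (λ _ → 1ℚ)

  scale : ∀ {N} → ℚ → Weighted N → Weighted N
  scale s = List.map (map₁ (s *_))

  infixr 7 _⊠_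
  _⊠_ : ∀ {n m} → Weighted n → Weighted m → Weighted (n ℕ.+ m)
  L₁ ⊠ L₂ = List.concatMap (λ t → scale (proj₁ t) (List.map (map₂ (proj₂ t ++_)) L₂)) L₁

  foldr-weights : ∀ {N} (L : Weighted N) → List.foldr _+_ 0ℚ (List.map proj₁ L) ≡ totalWeight L
  foldr-weights [] = ≡.refl
  foldr-weights ((l , _) ∷ L) = ≡.cong₂ _+_ (≡.sym (*-identityʳ l)) (foldr-weights L)

  weightedSum-cong : ∀ {N} (L : Weighted N) {w w′} → (∀ e → w e ≡ w′ e) → weightedSum L w ≡ weightedSum L w′
  weightedSum-cong [] _ = ≡.refl
  weightedSum-cong ((l , e) ∷ L) w≗w′ = ≡.cong₂ (λ x y → l * x + y) (w≗w′ e) (weightedSum-cong L w≗w′)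

  weightedSum-++ : ∀ {N} (L₁ L₂ : Weighted N) w →
                   weightedSum (L₁ List.++ L₂) w ≡ weightedSum L₁ w + weightedSum L₂ w
  weightedSum-++ [] L₂ w = ≡.sym (+-identityˡ _)
  weightedSum-++ ((l , e) ∷ L₁) L₂ w =
    ≡.trans (≡.cong (l * w e +_) (weightedSum-++ L₁ L₂ w)) (≡.sym (+-assoc (l * w e) _ _))

  weightedSum-map₂ : ∀ {N M} (φ : Vec ℕ N → Vec ℕ M) L w →
                             weightedSum (List.map (map₂ φ) L) w ≡ weightedSum L (λ e → w (φ e))
  weightedSum-map₂ φ [] w = ≡.refl
  weightedSum-map₂ φ ((l , e) ∷ L) w = ≡.cong (l * w (φ e) +_) (weightedSum-map₂ φ L w)

  weightedSum-scale : ∀ {N} s (L : Weighted N) w → weightedSum (scale s L) w ≡ s * weightedSum L w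
  weightedSum-scale s [] w = ≡.sym (*-zeroʳ s)
  weightedSum-scale s ((l , e) ∷ L) w = begin
    s * l * w e + weightedSum (scale s L) w ≡⟨ ≡.cong₂ _+_ (*-assoc s l (w e)) (weightedSum-scale s L w) ⟩
    s * (l * w e) + s * weightedSum L w     ≡⟨ *-distribˡ-+ s _ _ ⟨
    s * (l * w e + weightedSum L w)         ∎

  totalWeight-scale : ∀ {N} t (L : Weighted N) → totalWeight (scale t L) ≡ t * totalWeight L
  totalWeight-scale t L = weightedSum-scale t L (λ _ → 1ℚ)

  weightedSum-const : ∀ {N} (L : Weighted N) c → weightedSum L (λ _ → c) ≡ c * totalWeight L
  weightedSum-const [] c = ≡.sym (*-zeroʳ c)
  weightedSum-const ((l , e) ∷ L) c = begin
    l * c + weightedSum L (λ _ → c)   ≡⟨ ≡.cong₂ _+_ (*-comm l c) (weightedSum-const L c) ⟩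
    c * l + c * totalWeight L         ≡⟨ ≡.cong (λ x → c * x + c * totalWeight L) (*-identityʳ l) ⟨
    c * (l * 1ℚ) + c * totalWeight L  ≡⟨ *-distribˡ-+ c _ _ ⟨
    c * (l * 1ℚ + totalWeight L)      ∎

  weightedSum-0 : ∀ {N} (L : Weighted N) {w} → (∀ e → w e ≡ 0ℚ) → weightedSum L w ≡ 0ℚ
  weightedSum-0 L w≗0 =
    ≡.trans (weightedSum-cong L w≗0) (≡.trans (weightedSum-const L 0ℚ) (*-zeroˡ (totalWeight L)))

  weightedSum-const-1 : ∀ {N} (L : Weighted N) c → totalWeight L ≡ 1ℚ → weightedSum L (λ _ → c) ≡ c
  weightedSum-const-1 L c weight≡1 =
    ≡.trans (weightedSum-const L c) (≡.trans (≡.cong (c *_) weight≡1) (*-identityʳ c))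

  weightedSum-⊠ : ∀ {n m} (L₁ : Weighted n) (L₂ : Weighted m) w →
                  weightedSum (L₁ ⊠ L₂) w ≡ weightedSum L₁ (λ a → weightedSum L₂ (λ b → w (a ++ b)))
  weightedSum-⊠ [] L₂ w = ≡.refl
  weightedSum-⊠ ((l , a) ∷ L₁) L₂ w = begin
    weightedSum (scale l (List.map (map₂ (a ++_)) L₂) List.++ L₁ ⊠ L₂) w
      ≡⟨ weightedSum-++ (scale l (List.map (map₂ (a ++_)) L₂)) (L₁ ⊠ L₂) w ⟩
    weightedSum (scale l (List.map (map₂ (a ++_)) L₂)) w + weightedSum (L₁ ⊠ L₂) w
      ≡⟨ ≡.cong₂ _+_ (≡.trans (weightedSum-scale l (List.map (map₂ (a ++_)) L₂) w)
                              (≡.cong (l *_) (weightedSum-map₂ (a ++_) L₂ w)))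
                     (weightedSum-⊠ L₁ L₂ w) ⟩
    l * weightedSum L₂ (λ b → w (a ++ b)) + weightedSum L₁ (λ a → weightedSum L₂ (λ b → w (a ++ b))) ∎

  weightedSum-mono : ∀ {N} (L : Weighted N) {w w′} → NonNegWeights L → (∀ e → w e ≤ w′ e) →
                     weightedSum L w ≤ weightedSum L w′
  weightedSum-mono [] _ _ = ≤-refl
  weightedSum-mono ((l , e) ∷ L) (0≤l ∷ 0≤L) w≤w′ =
    +-mono-≤ (*-monoˡ-≤-nonNeg l {{ℚ.nonNegative 0≤l}} (w≤w′ e)) (weightedSum-mono L 0≤L w≤w′)

  totalWeight-nonNeg : ∀ {N} (L : Weighted N) → NonNegWeights L → 0ℚ ≤ totalWeight L
  totalWeight-nonNeg L 0≤L = ≡.subst (_≤ totalWeight L) (weightedSum-0 L λ _ → ≡.refl)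
    (weightedSum-mono L 0≤L λ _ → ℚ.*≤* (ℤ.+≤+ ℕ.z≤n))

module Juxtaposition (n m : ℕ) where

  open WeightedExponents
  open import Data.Rational using (_+_; _*_)

  ++-elim : ∀ {p} {P : Vec ℕ (n ℕ.+ m) → Set p} → (∀ a b → P (a ++ b)) → ∀ v → P v
  ++-elim {P = P} P++ v = ≡.subst P (Vecₚ.take++drop≡id n v) (P++ (Vec.take n v) (Vec.drop n v))

  ↑-elim : ∀ {p} {P : Fin (n ℕ.+ m) → Set p} → (∀ i → P (i ↑ˡ m)) → (∀ j → P (n ↑ʳ j)) → ∀ i → P i
  ↑-elim {P = P} Pˡ Pʳ i =
    ≡.subst P (Finₚ.join-splitAt n m i) (Data.Sum.[_,_] {C = P ∘ Fin.join n m} Pˡ Pʳ (Fin.splitAt n i))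

  coord-++ˡ : ∀ i (a : Vec ℕ n) (b : Vec ℕ m) → coord (i ↑ˡ m) (a ++ b) ≡ coord i a
  coord-++ˡ i a b = ≡.cong fromℕ (Vecₚ.lookup-++ˡ a b i)

  coord-++ʳ : ∀ j (a : Vec ℕ n) (b : Vec ℕ m) → coord (n ↑ʳ j) (a ++ b) ≡ coord j b
  coord-++ʳ j a b = ≡.cong fromℕ (Vecₚ.lookup-++ʳ a b j)

  weightedSum-ˡ-++0 : ∀ (L : Weighted n) i →
                      weightedSum L (λ a → coord (i ↑ˡ m) (a ++ 0ᵛ m)) ≡ weightedSum L (coord i)
  weightedSum-ˡ-++0 L i = weightedSum-cong L λ a → coord-++ˡ i a (0ᵛ m)

  weightedSum-ʳ-++0 : ∀ (L : Weighted n) j → weightedSum L (λ a → coord (n ↑ʳ j) (a ++ 0ᵛ m)) ≡ 0ℚ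
  weightedSum-ʳ-++0 L j = weightedSum-0 L λ a → ≡.trans (coord-++ʳ j a (0ᵛ m)) (coord-0ᵛ j)

  weightedSum-ˡ-0++ : ∀ (L : Weighted m) i → weightedSum L (λ b → coord (i ↑ˡ m) (0ᵛ n ++ b)) ≡ 0ℚ
  weightedSum-ˡ-0++ L i = weightedSum-0 L λ b → ≡.trans (coord-++ˡ i (0ᵛ n) b) (coord-0ᵛ i)

  weightedSum-ʳ-0++ : ∀ (L : Weighted m) j →
                      weightedSum L (λ b → coord (n ↑ʳ j) (0ᵛ n ++ b)) ≡ weightedSum L (coord j)
  weightedSum-ʳ-0++ L j = weightedSum-cong L λ b → coord-++ʳ j (0ᵛ n) b

  mix : ℚ → ℚ → Weighted n → Weighted m → Weighted (n ℕ.+ m)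
  mix α β L₁ L₂ = scale α (List.map (map₂ (_++ 0ᵛ m)) L₁) List.++ scale β (List.map (map₂ (0ᵛ n ++_)) L₂)

  weightedSum-mix : ∀ α β L₁ L₂ w → weightedSum (mix α β L₁ L₂) w
                    ≡ α * weightedSum L₁ (λ a → w (a ++ 0ᵛ m)) + β * weightedSum L₂ (λ b → w (0ᵛ n ++ b))
  weightedSum-mix α β L₁ L₂ w = ≡.trans (weightedSum-++ (scale α L₁′) (scale β L₂′) w) (≡.cong₂ _+_
    (≡.trans (weightedSum-scale α L₁′ w) (≡.cong (α *_) (weightedSum-map₂ (_++ 0ᵛ m) L₁ w)))
    (≡.trans (weightedSum-scale β L₂′ w) (≡.cong (β *_) (weightedSum-map₂ (0ᵛ n ++_) L₂ w))))
    where
    L₁′ = List.map (map₂ (_++ 0ᵛ m)) L₁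
    L₂′ = List.map (map₂ (0ᵛ n ++_)) L₂

  take-coordinatewise : CoordinatewiseMap (Vec.take n {m})
  take-coordinatewise i = inj₁ (i ↑ˡ m , λ v →
    ≡.trans (≡.sym (coord-++ˡ i (Vec.take n v) (Vec.drop n v)))
            (≡.cong (coord (i ↑ˡ m)) (Vecₚ.take++drop≡id n v)))

  drop-coordinatewise : CoordinatewiseMap (Vec.drop n {m})
  drop-coordinatewise j = inj₁ (n ↑ʳ j , λ v →
    ≡.trans (≡.sym (coord-++ʳ j (Vec.take n v) (Vec.drop n v)))
            (≡.cong (coord (n ↑ʳ j)) (Vecₚ.take++drop≡id n v)))

  ++0-coordinatewise : CoordinatewiseMap (_++ 0ᵛ m)
  ++0-coordinatewise = ↑-elim (λ i → inj₁ (i , λ a → coord-++ˡ i a (0ᵛ m)))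
                              (λ j → inj₂ λ a → ≡.trans (coord-++ʳ j a (0ᵛ m)) (coord-0ᵛ j))

  0++-coordinatewise : CoordinatewiseMap (0ᵛ n ++_)
  0++-coordinatewise = ↑-elim (λ i → inj₂ λ b → ≡.trans (coord-++ˡ i (0ᵛ n) b) (coord-0ᵛ i))
                              (λ j → inj₁ (j , λ b → coord-++ʳ j (0ᵛ n) b))

module FieldProperties {c ℓ} (k : Field c ℓ) where

  open Field k
  open import Relation.Binary.Reasoning.Setoid setoid

  x≉0∧y≉0⇒x*y≉0 : ∀ {x y} → ¬ x ≈ 0# → ¬ y ≈ 0# → ¬ (x * y) ≈ 0#
  x≉0∧y≉0⇒x*y≉0 {x} {y} x≉0 y≉0 xy≈0 = y≉0 (begin
    y                ≈⟨ *-identityˡ y ⟨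
    1# * y           ≈⟨ *-congʳ (trans (*-comm x⁻¹ x) xx⁻¹≈1) ⟨
    (x⁻¹ * x) * y    ≈⟨ *-assoc x⁻¹ x y ⟩
    x⁻¹ * (x * y)    ≈⟨ *-congˡ xy≈0 ⟩
    x⁻¹ * 0#         ≈⟨ zeroʳ x⁻¹ ⟩
    0#               ∎)
    where
    x⁻¹ = proj₁ (inverse x x≉0)
    xx⁻¹≈1 = proj₂ (inverse x x≉0)

  x*y≉0⇒x≉0 : ∀ {x y} → ¬ (x * y) ≈ 0# → ¬ x ≈ 0#
  x*y≉0⇒x≉0 {y = y} xy≉0 x≈0 = xy≉0 (trans (*-congʳ x≈0) (zeroˡ y))

  x*y≉0⇒y≉0 : ∀ {x y} → ¬ (x * y) ≈ 0# → ¬ y ≈ 0#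
  x*y≉0⇒y≉0 {x} xy≉0 y≈0 = xy≉0 (trans (*-congˡ y≈0) (zeroʳ x))

module Coefficients {c ℓ} (k : Field c ℓ) where

  open Field k
  open import Relation.Binary.Reasoning.Setoid setoid
  open import Algebra.Properties.CommutativeSemigroup +-commutativeSemigroup using (x∙yz≈y∙xz)

  infix 4 _≟ᵉ_
  _≟ᵉ_ : ∀ {N} (e e′ : Vec ℕ N) → Dec (e ≡ e′)
  _≟ᵉ_ = Vecₚ.≡-dec ℕₚ._≟_

  InSupport : ∀ {N} → Poly k N → Vec ℕ N → Set ℓ
  InSupport h e = ¬ (coeff k h e ≈ 0#)

  private
    variable
      N M : ℕ

  coeff-∷-≡ : ∀ a (e : Vec ℕ N) h → coeff k ((a , e) ∷ h) e ≈ a + coeff k h e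
  coeff-∷-≡ a e h with e ≟ᵉ e
  ... | yes _ = refl
  ... | no e≢e = contradiction ≡.refl e≢e

  coeff-∷-≢ : ∀ a {e i : Vec ℕ N} h → e ≢ i → coeff k ((a , e) ∷ h) i ≈ coeff k h i
  coeff-∷-≢ a {e} {i} h e≢i with e ≟ᵉ i
  ... | yes e≡i = contradiction e≡i e≢i
  ... | no _ = refl

  coeff-⊕ : ∀ (h h′ : Poly k N) i → coeff k (_⊕_ k h h′) i ≈ coeff k h i + coeff k h′ i
  coeff-⊕ [] h′ i = sym (+-identityˡ _)
  coeff-⊕ ((a , e) ∷ h) h′ i with e ≟ᵉ i
  ... | yes _ = trans (+-congˡ (coeff-⊕ h h′ i)) (sym (+-assoc a _ _))
  ... | no _ = coeff-⊕ h h′ i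

  coeff-∷-cong : ∀ a (x : Vec ℕ N) {h h′ i} → coeff k h i ≈ coeff k h′ i →
                 coeff k ((a , x) ∷ h) i ≈ coeff k ((a , x) ∷ h′) i
  coeff-∷-cong a x {i = i} h≈h′ with x ≟ᵉ i
  ... | yes _ = +-congˡ h≈h′
  ... | no _ = h≈h′

  coeff-map₂-injective : ∀ {φ : Vec ℕ N → Vec ℕ M} → Injective _≡_ _≡_ φ → ∀ h e →
                         coeff k (List.map (map₂ φ) h) (φ e) ≈ coeff k h e
  coeff-map₂-injective φ-inj [] e = refl
  coeff-map₂-injective {φ = φ} φ-inj ((a , x) ∷ h) e with x ≟ᵉ e
  ... | yes ≡.refl = trans (coeff-∷-≡ a (φ x) _) (+-congˡ (coeff-map₂-injective φ-inj h x))
  ... | no x≢e = trans (coeff-∷-≢ a _ (x≢e ∘ φ-inj)) (coeff-map₂-injective φ-inj h e)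

  removeExponent : Vec ℕ N → Poly k N → Poly k N
  removeExponent e = List.filter (λ t → ¬? (proj₂ t ≟ᵉ e))

  coeff-remove-≡ : ∀ e (h : Poly k N) → coeff k (removeExponent e h) e ≈ 0#
  coeff-remove-≡ e [] = refl
  coeff-remove-≡ e ((a , x) ∷ h) with x ≟ᵉ e
  ... | yes _ = coeff-remove-≡ e h
  ... | no x≢e = trans (coeff-∷-≢ a _ x≢e) (coeff-remove-≡ e h)

  coeff-remove-≢ : ∀ {e i} (h : Poly k N) → i ≢ e → coeff k (removeExponent e h) i ≈ coeff k h i
  coeff-remove-≢ [] _ = refl
  coeff-remove-≢ {e = e} ((a , x) ∷ h) i≢e with x ≟ᵉ e
  ... | yes ≡.refl = trans (coeff-remove-≢ h i≢e) (sym (coeff-∷-≢ a h (i≢e ∘ ≡.sym)))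
  ... | no _ = coeff-∷-cong a x (coeff-remove-≢ h i≢e)

  length-remove-∷ : ∀ a (x : Vec ℕ N) h → List.length (removeExponent x ((a , x) ∷ h)) ℕ.≤ List.length h
  length-remove-∷ a x h
    rewrite Listₚ.filter-reject (λ t → ¬? (proj₂ t ≟ᵉ x)) {(a , x)} {h} (λ x≢x → x≢x ≡.refl) =
      Listₚ.length-filter (λ t → ¬? (proj₂ t ≟ᵉ x)) h

  coeff-map₂-remove : ∀ (φ : Vec ℕ N → Vec ℕ M) {x e′} → φ x ≡ e′ → ∀ h →
                      coeff k (List.map (map₂ φ) h) e′
                        ≈ coeff k h x + coeff k (List.map (map₂ φ) (removeExponent x h)) e′
  coeff-map₂-remove φ ≡.refl [] = sym (+-identityˡ 0#)
  coeff-map₂-remove φ {x} ≡.refl ((a , y) ∷ h) with y ≟ᵉ x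
  ... | yes ≡.refl =
    trans (coeff-∷-≡ a (φ y) _) (trans (+-congˡ (coeff-map₂-remove φ ≡.refl h)) (sym (+-assoc a _ _)))
  ... | no _ with φ y ≟ᵉ φ x
  ...   | yes _ = trans (+-congˡ (coeff-map₂-remove φ ≡.refl h)) (x∙yz≈y∙xz a _ _)
  ...   | no _ = coeff-map₂-remove φ ≡.refl h

  -- The terms with a given exponent x may be scattered through h; removing them all at once
  -- (they contribute coeff h x) keeps the induction on the length of h going.
  coeff-map₂-≈0 : ∀ (φ : Vec ℕ N → Vec ℕ M) e′ h → (∀ e → φ e ≡ e′ → coeff k h e ≈ 0#) →
                  coeff k (List.map (map₂ φ) h) e′ ≈ 0#
  coeff-map₂-≈0 φ e′ h = go (List.length h) h ℕₚ.≤-refl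
    where
    go : ∀ n h → List.length h ℕ.≤ n → (∀ e → φ e ≡ e′ → coeff k h e ≈ 0#) →
         coeff k (List.map (map₂ φ) h) e′ ≈ 0#
    go _ [] _ _ = refl
    go (suc n) ((a , x) ∷ h) (ℕ.s≤s |h|≤n) fibre≈0 = split (φ x ≟ᵉ e′)
      where
      split : Dec (φ x ≡ e′) → coeff k (List.map (map₂ φ) ((a , x) ∷ h)) e′ ≈ 0#
      split (no φx≢e′) = trans (coeff-∷-≢ a _ φx≢e′) (go n h |h|≤n λ e φe≡e′ →
        trans (sym (coeff-∷-≢ a h λ x≡e → φx≢e′ (≡.trans (≡.cong φ x≡e) φe≡e′))) (fibre≈0 e φe≡e′))
      split (yes φx≡e′) = begin
        coeff k (List.map (map₂ φ) ((a , x) ∷ h)) e′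
          ≈⟨ coeff-map₂-remove φ φx≡e′ ((a , x) ∷ h) ⟩
        coeff k ((a , x) ∷ h) x + coeff k (List.map (map₂ φ) rest) e′
          ≈⟨ +-cong (fibre≈0 x φx≡e′) (go n rest |rest|≤n rest-fibre≈0) ⟩
        0# + 0#
          ≈⟨ +-identityˡ 0# ⟩
        0# ∎
        where
        rest = removeExponent x ((a , x) ∷ h)
        |rest|≤n = ℕₚ.≤-trans (length-remove-∷ a x h) |h|≤n
        rest-fibre≈0 : ∀ e → φ e ≡ e′ → coeff k rest e ≈ 0#
        rest-fibre≈0 e φe≡e′ with e ≟ᵉ x
        ... | yes ≡.refl = coeff-remove-≡ e ((a , x) ∷ h)
        ... | no e≢x = trans (coeff-remove-≢ ((a , x) ∷ h) e≢x) (fibre≈0 e φe≡e′)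

  coeff-scale : ∀ a (h : Poly k N) i → coeff k (List.map (map₁ (a *_)) h) i ≈ a * coeff k h i
  coeff-scale a [] i = sym (zeroʳ a)
  coeff-scale a ((b , e) ∷ h) i with e ≟ᵉ i
  ... | yes _ = trans (+-congˡ (coeff-scale a h i)) (sym (distribˡ a b _))
  ... | no _ = coeff-scale a h i

  coeff-embedˣ : ∀ {n} m (f : Poly k n) a → coeff k (embedˣ k m f) (a ++ 0ᵛ m) ≈ coeff k f a
  coeff-embedˣ m = coeff-map₂-injective (Vecₚ.++-injectiveˡ _ _)

  coeff-embedˣ-≢ : ∀ {n} m (f : Poly k n) a b → b ≢ 0ᵛ m → coeff k (embedˣ k m f) (a ++ b) ≈ 0#
  coeff-embedˣ-≢ m f a b b≢0 = coeff-map₂-≈0 _ (a ++ b) f λ e e++0≡a++b →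
    contradiction (≡.sym (Vecₚ.++-injectiveʳ e a e++0≡a++b)) b≢0

  coeff-embedʸ : ∀ n {m} (g : Poly k m) b → coeff k (embedʸ k n g) (0ᵛ n ++ b) ≈ coeff k g b
  coeff-embedʸ n = coeff-map₂-injective (Vecₚ.++-injectiveʳ (0ᵛ n) (0ᵛ n))

  coeff-embedʸ-≢ : ∀ n {m} (g : Poly k m) a b → a ≢ 0ᵛ n → coeff k (embedʸ k n g) (a ++ b) ≈ 0#
  coeff-embedʸ-≢ n g a b a≢0 = coeff-map₂-≈0 _ (a ++ b) g λ e 0++e≡a++b →
    contradiction (≡.sym (Vecₚ.++-injectiveˡ (0ᵛ n) a 0++e≡a++b)) a≢0

  private
    shifted-row : ∀ {n m} c (e : Vec ℕ n) (g : Poly k m) →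
      List.map (λ t → (c * proj₁ t , Vec.zipWith ℕ._+_ (e ++ 0ᵛ m) (proj₂ t))) (embedʸ k n g)
        ≡ List.map (map₂ (e ++_)) (List.map (map₁ (c *_)) g)
    shifted-row {n} {m} c e g = ≡.trans (≡.sym (Listₚ.map-∘ g))
      (≡.trans (Listₚ.map-cong (λ t → ≡.cong (c * proj₁ t ,_) (e+0+0+e′≡e++e′ (proj₂ t))) g) (Listₚ.map-∘ g))
      where
      e+0+0+e′≡e++e′ : ∀ e′ → Vec.zipWith ℕ._+_ (e ++ 0ᵛ m) (0ᵛ n ++ e′) ≡ e ++ e′
      e+0+0+e′≡e++e′ e′ = ≡.trans (Vecₚ.zipWith-++ ℕ._+_ e (0ᵛ m) (0ᵛ n) e′)
        (≡.cong₂ _++_ (Vecₚ.zipWith-identityʳ ℕₚ.+-identityʳ e) (Vecₚ.zipWith-identityˡ ℕₚ.+-identityˡ e′))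

    coeff-shifted-row : ∀ {n m} c (e a : Vec ℕ n) (g : Poly k m) b →
      coeff k (List.map (map₂ (e ++_)) (List.map (map₁ (c *_)) g)) (a ++ b)
        ≈ coeff k ((c , e) ∷ []) a * coeff k g b
    coeff-shifted-row c e a g b with e ≟ᵉ a
    ... | yes ≡.refl = begin
      coeff k (List.map (map₂ (e ++_)) cg) (e ++ b) ≈⟨ coeff-map₂-injective (Vecₚ.++-injectiveʳ e e) cg b ⟩
      coeff k cg b                                  ≈⟨ coeff-scale c g b ⟩
      c * coeff k g b                               ≈⟨ *-congʳ (+-identityʳ c) ⟨
      (c + 0#) * coeff k g b                        ∎
      where cg = List.map (map₁ (c *_)) g
    ... | no e≢a = trans (coeff-map₂-≈0 (e ++_) (a ++ b) (List.map (map₁ (c *_)) g) λ e′ e++e′≡a++b →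
                            contradiction (Vecₚ.++-injectiveˡ e a e++e′≡a++b) e≢a)
                         (sym (zeroˡ _))

  coeff-⊗-embed : ∀ {n m} (f : Poly k n) (g : Poly k m) a b →
                  coeff k (_⊗_ k (embedˣ k m f) (embedʸ k n g)) (a ++ b) ≈ coeff k f a * coeff k g b
  coeff-⊗-embed [] g a b = sym (zeroˡ _)
  coeff-⊗-embed {n} {m} ((c , e) ∷ f) g a b = begin
    coeff k (row List.++ rest) (a ++ b)                           ≈⟨ coeff-⊕ row rest (a ++ b) ⟩
    coeff k row (a ++ b) + coeff k rest (a ++ b)                  ≈⟨ +-cong row≈ (coeff-⊗-embed f g a b) ⟩
    coeff k ((c , e) ∷ []) a * coeff k g b + coeff k f a * coeff k g b ≈⟨ distribʳ _ _ _ ⟨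
    (coeff k ((c , e) ∷ []) a + coeff k f a) * coeff k g b        ≈⟨ *-congʳ (coeff-⊕ ((c , e) ∷ []) f a) ⟨
    coeff k ((c , e) ∷ f) a * coeff k g b                         ∎
    where
    row = List.map (λ t → (c * proj₁ t , Vec.zipWith ℕ._+_ (e ++ 0ᵛ m) (proj₂ t))) (embedʸ k n g)
    rest = _⊗_ k (embedˣ k m f) (embedʸ k n g)
    row≈ : coeff k row (a ++ b) ≈ coeff k ((c , e) ∷ []) a * coeff k g b
    row≈ = trans (reflexive (≡.cong (λ L → coeff k L (a ++ b)) (shifted-row c e g)))
                 (coeff-shifted-row c e a g b)

  coeff-∈-or-≈0 : ∀ (h : Poly k N) i → i ∈ List.map proj₂ h ⊎ coeff k h i ≈ 0#
  coeff-∈-or-≈0 [] i = inj₂ refl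
  coeff-∈-or-≈0 ((a , e) ∷ h) i with e ≟ᵉ i
  ... | yes ≡.refl = inj₁ (here ≡.refl)
  ... | no e≢i = Data.Sum.map₁ there (coeff-∈-or-≈0 h i)

  support-¬¬-shift : ∀ {p} {P : Vec ℕ N → Set p} (h : Poly k N) →
                     (∀ e → ¬ ¬ P e) → ¬ ¬ (∀ e → P e ⊎ coeff k h e ≈ 0#)
  support-¬¬-shift h ¬¬P ¬shift = All.sequenceM _ ¬¬-Monad (All.tabulate λ {e} _ → ¬¬P e) λ all →
    ¬shift λ e → Data.Sum.map₁ (All.lookup all) (coeff-∈-or-≈0 h e)

  nonZero⇒¬¬support : ∀ (h : Poly k N) → ¬ IsZeroPoly k h → ¬ ¬ Σ (Vec ℕ N) (InSupport h)
  nonZero⇒¬¬support h h≉0 ∄e = support-¬¬-shift h (λ e e≉0 → ∄e (e , e≉0)) λ shift →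
    h≉0 λ e → Data.Sum.reduce (shift e)

  support-map₂ : ∀ (φ : Vec ℕ N → Vec ℕ M) (h : Poly k N) e′ → InSupport (List.map (map₂ φ) h) e′ →
                 ¬ ¬ Σ (Vec ℕ N) λ e → φ e ≡ e′ × InSupport h e
  support-map₂ φ h e′ e′∈supp ∄e = support-¬¬-shift h fibre-¬¬ λ shift →
    e′∈supp (coeff-map₂-≈0 φ e′ h λ e φe≡e′ → [ (λ fibre → fibre φe≡e′) , id ]′ (shift e))
    where
    fibre-¬¬ : ∀ e → ¬ ¬ (φ e ≡ e′ → coeff k h e ≈ 0#)
    fibre-¬¬ e ¬fibre = ¬fibre λ φe≡e′ → contradiction (e , φe≡e′ , λ e≈0 → ¬fibre λ _ → e≈0) ∄e

module NewtonPolyhedron {c ℓ} (k : Field c ℓ) where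

  open Coefficients k using (InSupport)
  open WeightedExponents
  open Reciprocals
  open import Data.Rational using (_+_; _*_; _≤_; _<_)
  open import Data.Rational.Properties

  private
    variable
      N : ℕ

  Supported : Poly k N → Weighted N → Set ℓ
  Supported h = All (λ t → 0ℚ ≤ proj₁ t × InSupport h (proj₂ t))

  InNewtonDiag : Poly k N → ℚ → Set ℓ
  InNewtonDiag {N} h r =
    Σ (Weighted N) λ L → Supported h L × totalWeight L ≡ 1ℚ × (∀ i → weightedSum L (coord i) ≤ r)

  lookup-combination : ∀ (L : Weighted N) i → Vec.lookup (combination k L) i ≡ weightedSum L (coord i)
  lookup-combination [] i = Vecₚ.lookup-replicate i 0ℚ
  lookup-combination ((l , e) ∷ L) i = begin
    Vec.lookup (Vec.zipWith _+_ (Vec.map (l *_) (toℚ k e)) (combination k L)) i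
      ≡⟨ Vecₚ.lookup-zipWith _+_ i (Vec.map (l *_) (toℚ k e)) (combination k L) ⟩
    Vec.lookup (Vec.map (l *_) (toℚ k e)) i + Vec.lookup (combination k L) i
      ≡⟨ ≡.cong₂ _+_ (≡.trans (Vecₚ.lookup-map i (l *_) (toℚ k e)) (≡.cong (l *_) (Vecₚ.lookup-map i fromℕ e)))
                     (lookup-combination L i) ⟩
    l * coord i e + weightedSum L (coord i) ∎
    where open ≡.≡-Reasoning

  inNewton⇒diag : ∀ (h : Poly k N) r → InNewton k h (replicate N r) → InNewtonDiag h r
  inNewton⇒diag h r (L , supp , weights≡1 , L≤r) = L , supp , ≡.trans (≡.sym (foldr-weights L)) weights≡1 ,
    λ i → ≡.subst₂ _≤_ (lookup-combination L i) (Vecₚ.lookup-replicate i r) (Pointwise.lookup L≤r i)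

  diag⇒inNewton : ∀ (h : Poly k N) r → InNewtonDiag h r → InNewton k h (replicate N r)
  diag⇒inNewton h r (L , supp , weight≡1 , L≤r) = L , supp , ≡.trans (foldr-weights L) weight≡1 ,
    extensional⇒inductive (ext λ i →
      ≡.subst₂ _≤_ (≡.sym (lookup-combination L i)) (≡.sym (Vecₚ.lookup-replicate i r)) (L≤r i))

  diag⇒admissible : ∀ (h : Poly k N) s (0<s : 0ℚ < s) → InNewtonDiag h (1/pos s 0<s) → Admissible k h s
  diag⇒admissible h s 0<s inΔ = 0<s , diag⇒inNewton h _ inΔ

  supported-scale : ∀ (h : Poly k N) t → 0ℚ ≤ t → ∀ {L} → Supported h L → Supported h (scale t L)
  supported-scale h t 0≤t [] = []
  supported-scale h t 0≤t ((0≤l , e∈supp) ∷ supp) =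
    (nonNegative⁻¹ _ {{nonNeg*nonNeg⇒nonNeg t {{ℚ.nonNegative 0≤t}} _ {{ℚ.nonNegative 0≤l}}}} , e∈supp)
      ∷ supported-scale h t 0≤t supp

  supported-map₂ : ∀ {M} (h : Poly k N) (h′ : Poly k M) (φ : Vec ℕ N → Vec ℕ M) →
                   (∀ e → InSupport h e → InSupport h′ (φ e)) →
                   ∀ {L} → Supported h L → Supported h′ (List.map (map₂ φ) L)
  supported-map₂ h h′ φ φ-supp [] = []
  supported-map₂ h h′ φ φ-supp ((0≤l , e∈supp) ∷ supp) =
    (0≤l , φ-supp _ e∈supp) ∷ supported-map₂ h h′ φ φ-supp supp

  inNewtonDiag-weaken : ∀ (h : Poly k N) {r r′} → r ≤ r′ → InNewtonDiag h r → InNewtonDiag h r′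
  inNewtonDiag-weaken h r≤r′ (L , supp , weight≡1 , L≤r) = L , supp , weight≡1 , λ i → ≤-trans (L≤r i) r≤r′

  inNewtonDiag-map₂ : ∀ {M} (h : Poly k N) (h′ : Poly k M) (φ : Vec ℕ N → Vec ℕ M) → CoordinatewiseMap φ →
                      (∀ e → InSupport h e → InSupport h′ (φ e)) →
                      ∀ {r} → 0ℚ ≤ r → InNewtonDiag h r → InNewtonDiag h′ r
  inNewtonDiag-map₂ h h′ φ φ-coord φ-supp {r} 0≤r (L , supp , weight≡1 , L≤r) =
    List.map (map₂ φ) L , supported-map₂ h h′ φ φ-supp supp ,
    ≡.trans (weightedSum-map₂ φ L _) weight≡1 , bound
    where
    bound : ∀ j → weightedSum (List.map (map₂ φ) L) (coord j) ≤ r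
    bound j with φ-coord j
    ... | inj₁ (i , φ-j≡i) =
      ≡.subst (_≤ r) (≡.sym (≡.trans (weightedSum-map₂ φ L (coord j)) (weightedSum-cong L φ-j≡i))) (L≤r i)
    ... | inj₂ φ-j≡0 =
      ≡.subst (_≤ r) (≡.sym (≡.trans (weightedSum-map₂ φ L (coord j)) (weightedSum-0 L φ-j≡0))) 0≤r

  admissible-map : ∀ {M} (h : Poly k N) (h′ : Poly k M) →
                   (∀ {r} → 0ℚ ≤ r → InNewtonDiag h r → InNewtonDiag h′ r) →
                   ∀ {s} → Admissible k h s → Admissible k h′ s
  admissible-map h h′ diag-map {s} (0<s , inΔ) =
    diag⇒admissible h′ s 0<s (diag-map (<⇒≤ (1/pos-pos s 0<s)) (inNewton⇒diag h _ inΔ))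

  Admissible⁰ : Poly k N → ℚ → Set ℓ
  Admissible⁰ h s = Admissible k h s ⊎ s ≡ 0ℚ

  admissible-≤ : ∀ (h : Poly k N) {a a′} → 0ℚ < a′ → a′ ≤ a → Admissible k h a → Admissible k h a′
  admissible-≤ h {a} {a′} 0<a′ a′≤a (0<a , inΔ) = diag⇒admissible h a′ 0<a′
    (inNewtonDiag-weaken h (1/pos-antimono-≤ a′ 0<a′ a 0<a a′≤a) (inNewton⇒diag h _ inΔ))

  admissible⁰-nonNeg : ∀ (h : Poly k N) {s} → Admissible⁰ h s → 0ℚ ≤ s
  admissible⁰-nonNeg h (inj₁ (0<s , _)) = <⇒≤ 0<s
  admissible⁰-nonNeg h (inj₂ ≡.refl) = ≤-refl

  admissible⁰-rescale : ∀ (h : Poly k N) L s (0<s : 0ℚ < s) → Supported h L →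
                        (∀ i → weightedSum L (coord i) ≤ 1/pos s 0<s) → Admissible⁰ h (totalWeight L * s)
  admissible⁰-rescale h L s 0<s supp L≤1/s with 0ℚ ℚ.<? totalWeight L
  ... | no 0≮t = inj₂ (≡.trans (≡.cong (_* s) t≡0) (*-zeroˡ s))
    where
    t≡0 : totalWeight L ≡ 0ℚ
    t≡0 = ≤-antisym (≮⇒≥ 0≮t) (totalWeight-nonNeg L (All.map proj₁ supp))
  ... | yes 0<t = inj₁ (diag⇒admissible h (t * s) (*-pos 0<t 0<s) (scale t⁻¹ L ,
        supported-scale h t⁻¹ (<⇒≤ (1/pos-pos t 0<t)) supp ,
        ≡.trans (totalWeight-scale t⁻¹ L) (≡.trans (*-comm t⁻¹ t) (*-1/pos t 0<t)) ,
        bound))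
    where
    t = totalWeight L
    t⁻¹ = 1/pos t 0<t
    bound : ∀ i → weightedSum (scale t⁻¹ L) (coord i) ≤ 1/pos (t * s) (*-pos 0<t 0<s)
    bound i = begin
      weightedSum (scale t⁻¹ L) (coord i) ≡⟨ weightedSum-scale t⁻¹ L (coord i) ⟩
      t⁻¹ * weightedSum L (coord i)       ≤⟨ *-monoˡ-≤-nonNeg t⁻¹ {{ℚ.nonNegative (<⇒≤ (1/pos-pos t 0<t))}}
                                                                 (L≤1/s i) ⟩
      t⁻¹ * 1/pos s 0<s                   ≡⟨ 1/pos-* t 0<t s 0<s ⟨
      1/pos (t * s) (*-pos 0<t 0<s)       ∎
      where open ≤-Reasoning

  private
    lookup≤sum : ∀ (e : Vec ℕ N) i → Vec.lookup e i ℕ.≤ Vec.sum e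
    lookup≤sum (a ∷ e) Fin.zero = ℕₚ.m≤m+n a _
    lookup≤sum (a ∷ e) (Fin.suc i) = ℕₚ.≤-trans (lookup≤sum e i) (ℕₚ.m≤n+m _ a)

  -- The single point e lies below (K,…,K) for K = 1 + Σ e.
  support⇒admissible : ∀ (h : Poly k N) e → InSupport h e → Σ ℚ (Admissible k h)
  support⇒admissible h e e∈supp = s , diag⇒admissible h s 0<s
    ((1ℚ , e) ∷ [] , (<⇒≤ (positive⁻¹ 1ℚ) , e∈supp) ∷ [] , ≡.trans (+-identityʳ _) (*-identityˡ 1ℚ) , bound)
    where
    K = fromℕ (suc (Vec.sum e))
    0<K : 0ℚ < K
    0<K = positive⁻¹ K {{normalize-pos (suc (Vec.sum e)) 1}}
    s = 1/pos K 0<K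
    0<s = 1/pos-pos K 0<K
    bound : ∀ i → weightedSum ((1ℚ , e) ∷ []) (coord i) ≤ 1/pos s 0<s
    bound i = ≡.subst₂ _≤_ (≡.sym (≡.trans (+-identityʳ _) (*-identityˡ _)))
                           (≡.sym (1/-involutive K {{pos⇒nonZero K {{ℚ.positive 0<K}}}}))
                           (fromℕ-mono-≤ (ℕₚ.≤-trans (lookup≤sum e i) (ℕₚ.n≤1+n _)))

  nonZero⇒¬¬admissible : ∀ (h : Poly k N) → ¬ IsZeroPoly k h → ¬ ¬ Σ ℚ (Admissible k h)
  nonZero⇒¬¬admissible h h≉0 ∄s = Coefficients.nonZero⇒¬¬support k h h≉0 λ (e , e∈supp) →
    ∄s (support⇒admissible h e e∈supp)

  zero⇒¬admissible : ∀ (h : Poly k N) → IsZeroPoly k h → ∀ s → ¬ Admissible k h s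
  zero⇒¬admissible h h≈0 s (_ , [] , [] , () , _)
  zero⇒¬admissible h h≈0 s (_ , (_ ∷ _) , (_ , e∉supp) ∷ _ , _) = e∉supp (h≈0 _)

module SigmaAsLub {c ℓ} (k : Field c ℓ) where

  open ExtendedRationals
  open NewtonPolyhedron k
  open import Data.Rational.Properties using (<⇒≤)

  private
    variable
      N : ℕ

  nonZero⇒upperBound-nonNeg : ∀ (h : Poly k N) → ¬ IsZeroPoly k h →
                              ∀ u → UpperBound (Admissible k h) u → fin 0ℚ ≤∞ u
  nonZero⇒upperBound-nonNeg h h≉0 u u-ub = decidable-stable (fin 0ℚ ≤∞? u) λ 0≰u →
    nonZero⇒¬¬admissible h h≉0 λ (s , adm) → 0≰u (≤∞-trans (fin≤fin (<⇒≤ (proj₁ adm))) (u-ub s adm))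

  zero⇒upperBound-0 : ∀ (h : Poly k N) → IsZeroPoly k h → UpperBound (Admissible⁰ h) (fin 0ℚ)
  zero⇒upperBound-0 h h≈0 s (inj₁ adm) = ⊥-elim (zero⇒¬admissible h h≈0 s adm)
  zero⇒upperBound-0 h h≈0 s (inj₂ ≡.refl) = ≤∞-refl

  sigma⇒lub : ∀ (h : Poly k N) σ → IsSigma k h σ → IsLub (Admissible⁰ h) σ
  sigma⇒lub h _ (inj₁ (h≈0 , ≡.refl)) = zero⇒upperBound-0 h h≈0 , λ u u-ub → u-ub 0ℚ (inj₂ ≡.refl)
  sigma⇒lub h σ (inj₂ (h≉0 , σ-ub , σ-least)) = upper , λ u u-ub → σ-least u λ s adm → u-ub s (inj₁ adm)
    where
    upper : UpperBound (Admissible⁰ h) σ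
    upper s (inj₁ adm) = σ-ub s adm
    upper s (inj₂ ≡.refl) = nonZero⇒upperBound-nonNeg h h≉0 σ σ-ub

  lub⇒sigma : ∀ (h : Poly k N) σ → IsZeroPoly k h ⊎ ¬ IsZeroPoly k h → IsLub (Admissible⁰ h) σ → IsSigma k h σ
  lub⇒sigma h σ (inj₁ h≈0) (σ-ub , σ-least) =
    inj₁ (h≈0 , ≤∞-antisym (σ-least (fin 0ℚ) (zero⇒upperBound-0 h h≈0)) (σ-ub 0ℚ (inj₂ ≡.refl)))
  lub⇒sigma h σ (inj₂ h≉0) (σ-ub , σ-least) = inj₂ (h≉0 , (λ s adm → σ-ub s (inj₁ adm)) , least)
    where
    least : ∀ u → UpperBound (Admissible k h) u → σ ≤∞ u
    least u u-ub = σ-least u λ where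
      s (inj₁ adm) → u-ub s adm
      s (inj₂ ≡.refl) → nonZero⇒upperBound-nonNeg h h≉0 u u-ub

  sigma⇒zero⊎nonZero : ∀ (h : Poly k N) {σ} → IsSigma k h σ → IsZeroPoly k h ⊎ ¬ IsZeroPoly k h
  sigma⇒zero⊎nonZero h = Data.Sum.map proj₁ proj₁

module Sum {c ℓ} (k : Field c ℓ) {n m} (f : Poly k n) (g : Poly k m)
           (f₀≈0 : VanishesAtOrigin k f) (g₀≈0 : VanishesAtOrigin k g) where

  open Field k using (_≈_; 0#; sym; trans; +-cong; +-identityˡ; +-identityʳ) renaming (_+_ to _+ᵏ_)
  open Coefficients k
  open NewtonPolyhedron k
  open WeightedExponents
  open Juxtaposition n m
  open Reciprocals
  open import Data.Rational using (_+_; _*_; _≤_; _<_)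
  import Data.Rational.Properties as ℚₚ

  f+g : Poly k (n ℕ.+ m)
  f+g = _⊕_ k (embedˣ k m f) (embedʸ k n g)

  coeff-f+g : ∀ v → coeff k f+g v ≈ coeff k (embedˣ k m f) v +ᵏ coeff k (embedʸ k n g) v
  coeff-f+g = coeff-⊕ (embedˣ k m f) (embedʸ k n g)

  coeff-f+g-ˣ : ∀ a → a ≢ 0ᵛ n → coeff k f+g (a ++ 0ᵛ m) ≈ coeff k f a
  coeff-f+g-ˣ a a≢0 = trans (coeff-f+g (a ++ 0ᵛ m))
    (trans (+-cong (coeff-embedˣ m f a) (coeff-embedʸ-≢ n g a (0ᵛ m) a≢0)) (+-identityʳ _))

  coeff-f+g-ʸ : ∀ b → b ≢ 0ᵛ m → coeff k f+g (0ᵛ n ++ b) ≈ coeff k g b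
  coeff-f+g-ʸ b b≢0 = trans (coeff-f+g (0ᵛ n ++ b))
    (trans (+-cong (coeff-embedˣ-≢ m f (0ᵛ n) b b≢0) (coeff-embedʸ n g b)) (+-identityˡ _))

  coeff-f+g-0 : coeff k f+g (0ᵛ n ++ 0ᵛ m) ≈ 0#
  coeff-f+g-0 = trans (coeff-f+g (0ᵛ n ++ 0ᵛ m))
    (trans (+-cong (trans (coeff-embedˣ m f (0ᵛ n)) f₀≈0) (trans (coeff-embedʸ n g (0ᵛ m)) g₀≈0))
           (+-identityˡ 0#))

  coeff-f+g-≢ : ∀ a b → a ≢ 0ᵛ n → b ≢ 0ᵛ m → coeff k f+g (a ++ b) ≈ 0#
  coeff-f+g-≢ a b a≢0 b≢0 = trans (coeff-f+g (a ++ b))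
    (trans (+-cong (coeff-embedˣ-≢ m f a b b≢0) (coeff-embedʸ-≢ n g a b a≢0)) (+-identityˡ 0#))

  support-f+g : ∀ a b → InSupport f+g (a ++ b) → (b ≡ 0ᵛ m × InSupport f a) ⊎ (a ≡ 0ᵛ n × InSupport g b)
  support-f+g a b ab∈supp with a ≟ᵉ 0ᵛ n | b ≟ᵉ 0ᵛ m
  ... | yes ≡.refl | yes ≡.refl = contradiction coeff-f+g-0 ab∈supp
  ... | no a≢0 | yes ≡.refl = inj₁ (≡.refl , λ fa≈0 → ab∈supp (trans (coeff-f+g-ˣ a a≢0) fa≈0))
  ... | yes ≡.refl | no b≢0 = inj₂ (≡.refl , λ gb≈0 → ab∈supp (trans (coeff-f+g-ʸ b b≢0) gb≈0))
  ... | no a≢0 | no b≢0 = contradiction (coeff-f+g-≢ a b a≢0 b≢0) ab∈supp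

  support-f+gˣ : ∀ a → InSupport f a → InSupport f+g (a ++ 0ᵛ m)
  support-f+gˣ a a∈supp with a ≟ᵉ 0ᵛ n
  ... | yes ≡.refl = contradiction f₀≈0 a∈supp
  ... | no a≢0 = λ a0≈0 → a∈supp (trans (sym (coeff-f+g-ˣ a a≢0)) a0≈0)

  support-f+gʸ : ∀ b → InSupport g b → InSupport f+g (0ᵛ n ++ b)
  support-f+gʸ b b∈supp with b ≟ᵉ 0ᵛ m
  ... | yes ≡.refl = contradiction g₀≈0 b∈supp
  ... | no b≢0 = λ 0b≈0 → b∈supp (trans (sym (coeff-f+g-ʸ b b≢0)) 0b≈0)

  f+g-zero⊎nonZero : IsZeroPoly k f ⊎ ¬ IsZeroPoly k f → IsZeroPoly k g ⊎ ¬ IsZeroPoly k g →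
                     IsZeroPoly k f+g ⊎ ¬ IsZeroPoly k f+g
  f+g-zero⊎nonZero (inj₁ f≈0) (inj₁ g≈0) = inj₁ λ v → trans (coeff-f+g v)
    (trans (+-cong (coeff-map₂-≈0 (_++ 0ᵛ m) v f λ e _ → f≈0 e) (coeff-map₂-≈0 (0ᵛ n ++_) v g λ e _ → g≈0 e))
           (+-identityˡ 0#))
  f+g-zero⊎nonZero (inj₂ f≉0) _ = inj₂ λ f+g≈0 →
    nonZero⇒¬¬support f f≉0 λ (a , a∈supp) → support-f+gˣ a a∈supp (f+g≈0 _)
  f+g-zero⊎nonZero (inj₁ _) (inj₂ g≉0) = inj₂ λ f+g≈0 →
    nonZero⇒¬¬support g g≉0 λ (b , b∈supp) → support-f+gʸ b b∈supp (f+g≈0 _)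

  record Decomposition (L : Weighted (n ℕ.+ m)) : Set ℓ where
    field
      Lˣ : Weighted n
      Lʸ : Weighted m
      supportedˣ : Supported f Lˣ
      supportedʸ : Supported g Lʸ
      weightedSum-split : ∀ w → weightedSum L w
                                  ≡ weightedSum Lˣ (λ a → w (a ++ 0ᵛ m)) + weightedSum Lʸ (λ b → w (0ᵛ n ++ b))

  decompose : ∀ L → Supported f+g L → Decomposition L
  decompose [] [] = record { Lˣ = [] ; Lʸ = [] ; supportedˣ = [] ; supportedʸ = []
                           ; weightedSum-split = λ _ → ≡.sym (ℚₚ.+-identityʳ 0ℚ) }
  decompose ((l , v) ∷ L) ((0≤l , v∈supp) ∷ supp) with Vec.splitAt n v
  ... | a , b , ≡.refl with support-f+g a b v∈supp | decompose L supp
  ...   | inj₁ (≡.refl , a∈supp) | D = record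
          { Lˣ = (l , a) ∷ Lˣ ; Lʸ = Lʸ ; supportedˣ = (0≤l , a∈supp) ∷ supportedˣ ; supportedʸ = supportedʸ
          ; weightedSum-split = λ w → ≡.trans (≡.cong (l * w (a ++ 0ᵛ m) +_) (weightedSum-split w))
                                              (≡.sym (ℚₚ.+-assoc (l * w (a ++ 0ᵛ m)) _ _)) }
    where open Decomposition D
  ...   | inj₂ (≡.refl , b∈supp) | D = record
          { Lˣ = Lˣ ; Lʸ = (l , b) ∷ Lʸ ; supportedˣ = supportedˣ ; supportedʸ = (0≤l , b∈supp) ∷ supportedʸ
          ; weightedSum-split = λ w → ≡.trans (≡.cong (l * w (0ᵛ n ++ b) +_) (weightedSum-split w))
              (x∙yz≈y∙xz (l * w (0ᵛ n ++ b)) (weightedSum Lˣ (λ a → w (a ++ 0ᵛ m))) _) }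
    where
    open Decomposition D
    open import Algebra.Properties.CommutativeSemigroup
      (CommutativeMonoid.commutativeSemigroup ℚₚ.+-0-commutativeMonoid) using (x∙yz≈y∙xz)

  admissible-f+g-split : ∀ s → Admissible k f+g s →
                         Σ ℚ λ a → Σ ℚ λ b → Admissible⁰ f a × Admissible⁰ g b × s ≡ a + b
  admissible-f+g-split s (0<s , inΔ) with inNewton⇒diag f+g _ inΔ
  ... | L , supp , weight≡1 , L≤1/s =
    tˣ * s , tʸ * s , admissible⁰-rescale f Lˣ s 0<s supportedˣ boundˣ ,
    admissible⁰-rescale g Lʸ s 0<s supportedʸ boundʸ , s≡tˣs+tʸs
    where
    open Decomposition (decompose L supp)
    open ≡.≡-Reasoning
    tˣ = totalWeight Lˣ
    tʸ = totalWeight Lʸ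
    boundˣ : ∀ i → weightedSum Lˣ (coord i) ≤ 1/pos s 0<s
    boundˣ i = ≡.subst (_≤ 1/pos s 0<s)
      (≡.trans (weightedSum-split (coord (i ↑ˡ m)))
        (≡.trans (≡.cong₂ _+_ (weightedSum-ˡ-++0 Lˣ i) (weightedSum-ˡ-0++ Lʸ i)) (ℚₚ.+-identityʳ _)))
      (L≤1/s (i ↑ˡ m))
    boundʸ : ∀ j → weightedSum Lʸ (coord j) ≤ 1/pos s 0<s
    boundʸ j = ≡.subst (_≤ 1/pos s 0<s)
      (≡.trans (weightedSum-split (coord (n ↑ʳ j)))
        (≡.trans (≡.cong₂ _+_ (weightedSum-ʳ-++0 Lˣ j) (weightedSum-ʳ-0++ Lʸ j)) (ℚₚ.+-identityˡ _)))
      (L≤1/s (n ↑ʳ j))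
    s≡tˣs+tʸs : s ≡ tˣ * s + tʸ * s
    s≡tˣs+tʸs = begin
      s               ≡⟨ ℚₚ.*-identityˡ s ⟨
      1ℚ * s          ≡⟨ ≡.cong (_* s) (≡.trans (≡.sym weight≡1) (weightedSum-split (λ _ → 1ℚ))) ⟩
      (tˣ + tʸ) * s   ≡⟨ ℚₚ.*-distribʳ-+ s tˣ tʸ ⟩
      tˣ * s + tʸ * s ∎

  inNewtonDiag-f+g : ∀ {r₁ r₂ r} α β → 0ℚ ≤ α → 0ℚ ≤ β → α + β ≡ 1ℚ → α * r₁ ≤ r → β * r₂ ≤ r →
                     InNewtonDiag f r₁ → InNewtonDiag g r₂ → InNewtonDiag f+g r
  inNewtonDiag-f+g {r₁} {r₂} {r} α β 0≤α 0≤β α+β≡1 αr₁≤r βr₂≤r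
                   (L₁ , supp₁ , weight₁≡1 , L₁≤r₁) (L₂ , supp₂ , weight₂≡1 , L₂≤r₂) =
    mix α β L₁ L₂ , Allₚ.++⁺ (supported-scale f+g α 0≤α (supported-map₂ f f+g (_++ 0ᵛ m) support-f+gˣ supp₁))
                             (supported-scale f+g β 0≤β (supported-map₂ g f+g (0ᵛ n ++_) support-f+gʸ supp₂)) ,
    weight≡1 , ↑-elim {P = λ j → weightedSum L (coord j) ≤ r} boundˣ boundʸ
    where
    L = mix α β L₁ L₂
    weight≡1 : totalWeight L ≡ 1ℚ
    weight≡1 = ≡.trans (weightedSum-mix α β L₁ L₂ (λ _ → 1ℚ))
      (≡.trans (≡.cong₂ (λ x y → α * x + β * y) weight₁≡1 weight₂≡1)
        (≡.trans (≡.cong₂ _+_ (ℚₚ.*-identityʳ α) (ℚₚ.*-identityʳ β)) α+β≡1))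
    open ℚₚ.≤-Reasoning
    boundˣ : ∀ i → weightedSum L (coord (i ↑ˡ m)) ≤ r
    boundˣ i = begin
      weightedSum L (coord (i ↑ˡ m))
        ≡⟨ ≡.trans (weightedSum-mix α β L₁ L₂ (coord (i ↑ˡ m)))
             (≡.cong₂ (λ x y → α * x + β * y) (weightedSum-ˡ-++0 L₁ i) (weightedSum-ˡ-0++ L₂ i)) ⟩
      α * weightedSum L₁ (coord i) + β * 0ℚ
        ≡⟨ ≡.trans (≡.cong (α * weightedSum L₁ (coord i) +_) (ℚₚ.*-zeroʳ β)) (ℚₚ.+-identityʳ _) ⟩
      α * weightedSum L₁ (coord i)
        ≤⟨ ℚₚ.*-monoˡ-≤-nonNeg α {{ℚ.nonNegative 0≤α}} (L₁≤r₁ i) ⟩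
      α * r₁
        ≤⟨ αr₁≤r ⟩
      r ∎
    boundʸ : ∀ j → weightedSum L (coord (n ↑ʳ j)) ≤ r
    boundʸ j = begin
      weightedSum L (coord (n ↑ʳ j))
        ≡⟨ ≡.trans (weightedSum-mix α β L₁ L₂ (coord (n ↑ʳ j)))
             (≡.cong₂ (λ x y → α * x + β * y) (weightedSum-ʳ-++0 L₁ j) (weightedSum-ʳ-0++ L₂ j)) ⟩
      α * 0ℚ + β * weightedSum L₂ (coord j)
        ≡⟨ ≡.trans (≡.cong (_+ β * weightedSum L₂ (coord j)) (ℚₚ.*-zeroʳ α)) (ℚₚ.+-identityˡ _) ⟩
      β * weightedSum L₂ (coord j)
        ≤⟨ ℚₚ.*-monoˡ-≤-nonNeg β {{ℚ.nonNegative 0≤β}} (L₂≤r₂ j) ⟩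
      β * r₂
        ≤⟨ βr₂≤r ⟩
      r ∎

  -- Mixing with weights a/(a+b) and b/(a+b) bounds each block of coordinates by 1/(a+b).
  admissible-f+g : ∀ {a b} → Admissible k f a → Admissible k g b → Admissible k f+g (a + b)
  admissible-f+g {a} {b} (0<a , inΔf) (0<b , inΔg) = diag⇒admissible f+g (a + b) 0<a+b
    (inNewtonDiag-f+g (a * t) (b * t) (ℚₚ.<⇒≤ (*-pos 0<a 0<t)) (ℚₚ.<⇒≤ (*-pos 0<b 0<t)) at+bt≡1
      (ℚₚ.≤-reflexive (x*t*1/x≡t a 0<a)) (ℚₚ.≤-reflexive (x*t*1/x≡t b 0<b))
      (inNewton⇒diag f _ inΔf) (inNewton⇒diag g _ inΔg))
    where
    open +-*-Solver
    0<a+b : 0ℚ < a + b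
    0<a+b = ℚₚ.+-mono-< 0<a 0<b
    t = 1/pos (a + b) 0<a+b
    0<t = 1/pos-pos (a + b) 0<a+b
    at+bt≡1 : a * t + b * t ≡ 1ℚ
    at+bt≡1 = ≡.trans (≡.sym (ℚₚ.*-distribʳ-+ t a b)) (*-1/pos (a + b) 0<a+b)
    x*t*1/x≡t : ∀ x 0<x → x * t * 1/pos x 0<x ≡ t
    x*t*1/x≡t x 0<x = ≡.trans (solve 3 (λ x t y → (x :* t) :* y := t :* (x :* y)) ≡.refl x t (1/pos x 0<x))
                              (≡.trans (≡.cong (t *_) (*-1/pos x 0<x)) (ℚₚ.*-identityʳ t))

  admissible-f+gˣ : ∀ {a} → Admissible k f a → Admissible k f+g a
  admissible-f+gˣ = admissible-map f f+g (inNewtonDiag-map₂ f f+g (_++ 0ᵛ m) ++0-coordinatewise support-f+gˣ)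

  admissible-f+gʸ : ∀ {b} → Admissible k g b → Admissible k f+g b
  admissible-f+gʸ = admissible-map g f+g (inNewtonDiag-map₂ g f+g (0ᵛ n ++_) 0++-coordinatewise support-f+gʸ)

  admissible⁰-f+g : ∀ a b → Admissible⁰ f a → Admissible⁰ g b → Admissible⁰ f+g (a + b)
  admissible⁰-f+g a b (inj₁ adm-f) (inj₁ adm-g) = inj₁ (admissible-f+g adm-f adm-g)
  admissible⁰-f+g a _ (inj₁ adm-f) (inj₂ ≡.refl) =
    inj₁ (≡.subst (Admissible k f+g) (≡.sym (ℚₚ.+-identityʳ a)) (admissible-f+gˣ adm-f))
  admissible⁰-f+g _ b (inj₂ ≡.refl) (inj₁ adm-g) =
    inj₁ (≡.subst (Admissible k f+g) (≡.sym (ℚₚ.+-identityˡ b)) (admissible-f+gʸ adm-g))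
  admissible⁰-f+g _ _ (inj₂ ≡.refl) (inj₂ ≡.refl) = inj₂ (ℚₚ.+-identityˡ 0ℚ)

  admissible⁰-f+g-split : ∀ s → Admissible⁰ f+g s →
                          Σ ℚ λ a → Σ ℚ λ b → Admissible⁰ f a × Admissible⁰ g b × s ≡ a + b
  admissible⁰-f+g-split s (inj₁ adm) = admissible-f+g-split s adm
  admissible⁰-f+g-split _ (inj₂ ≡.refl) = 0ℚ , 0ℚ , inj₂ ≡.refl , inj₂ ≡.refl , ≡.sym (ℚₚ.+-identityˡ 0ℚ)

  sigma-f+g : ∀ σf σg → IsSigma k f σf → IsSigma k g σg → IsSigma k f+g (σf +∞ σg)
  sigma-f+g σf σg σf-sigma σg-sigma =
    lub⇒sigma f+g _ (f+g-zero⊎nonZero (sigma⇒zero⊎nonZero f σf-sigma) (sigma⇒zero⊎nonZero g σg-sigma))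
      (lub-+ (sigma⇒lub f σf σf-sigma) (sigma⇒lub g σg σg-sigma) (0ℚ , inj₂ ≡.refl)
             admissible⁰-f+g-split admissible⁰-f+g)
    where
    open ExtendedRationals using (lub-+)
    open SigmaAsLub k

module Product {c ℓ} (k : Field c ℓ) {n m} (f : Poly k n) (g : Poly k m) where

  open Field k using (trans; sym; *-congˡ; *-congʳ; zeroˡ; zeroʳ)
  open FieldProperties k
  open Coefficients k
  open NewtonPolyhedron k
  open WeightedExponents
  open Juxtaposition n m
  open import Data.Rational using (_≤_; _<_; _⊓_)
  import Data.Rational.Properties as ℚₚ

  fg : Poly k (n ℕ.+ m)
  fg = _⊗_ k (embedˣ k m f) (embedʸ k n g)

  support-fg : ∀ a b → InSupport f a → InSupport g b → InSupport fg (a ++ b)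
  support-fg a b a∈supp b∈supp ab≈0 = x≉0∧y≉0⇒x*y≉0 a∈supp b∈supp (trans (sym (coeff-⊗-embed f g a b)) ab≈0)

  support-fg⁻¹ : ∀ a b → InSupport fg (a ++ b) → InSupport f a × InSupport g b
  support-fg⁻¹ a b ab∈supp = x*y≉0⇒x≉0 fa*gb≉0 , x*y≉0⇒y≉0 fa*gb≉0
    where
    fa*gb≉0 = λ fa*gb≈0 → ab∈supp (trans (coeff-⊗-embed f g a b) fa*gb≈0)

  support-fg-take : ∀ v → InSupport fg v → InSupport f (Vec.take n v)
  support-fg-take v v∈supp =
    proj₁ (support-fg⁻¹ _ _ (≡.subst (InSupport fg) (≡.sym (Vecₚ.take++drop≡id n v)) v∈supp))

  support-fg-drop : ∀ v → InSupport fg v → InSupport g (Vec.drop n v)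
  support-fg-drop v v∈supp =
    proj₂ (support-fg⁻¹ _ _ (≡.subst (InSupport fg) (≡.sym (Vecₚ.take++drop≡id n v)) v∈supp))

  fg-zero⊎nonZero : IsZeroPoly k f ⊎ ¬ IsZeroPoly k f → IsZeroPoly k g ⊎ ¬ IsZeroPoly k g →
                    IsZeroPoly k fg ⊎ ¬ IsZeroPoly k fg
  fg-zero⊎nonZero (inj₁ f≈0) _ = inj₁ (++-elim λ a b →
    trans (coeff-⊗-embed f g a b) (trans (*-congʳ (f≈0 a)) (zeroˡ _)))
  fg-zero⊎nonZero (inj₂ _) (inj₁ g≈0) = inj₁ (++-elim λ a b →
    trans (coeff-⊗-embed f g a b) (trans (*-congˡ (g≈0 b)) (zeroʳ _)))
  fg-zero⊎nonZero (inj₂ f≉0) (inj₂ g≉0) = inj₂ λ fg≈0 →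
    nonZero⇒¬¬support f f≉0 λ (a , a∈supp) → nonZero⇒¬¬support g g≉0 λ (b , b∈supp) →
      support-fg a b a∈supp b∈supp (fg≈0 (a ++ b))

  supported-⊠ : ∀ {L₁ L₂} → Supported f L₁ → Supported g L₂ → Supported fg (L₁ ⊠ L₂)
  supported-⊠ [] _ = []
  supported-⊠ {(l , a) ∷ _} ((0≤l , a∈supp) ∷ supp₁) supp₂ = Allₚ.++⁺
    (supported-scale fg l 0≤l (supported-map₂ g fg (a ++_) (λ b b∈supp → support-fg a b a∈supp b∈supp) supp₂))
    (supported-⊠ supp₁ supp₂)

  inNewtonDiag-fg : ∀ {r} → InNewtonDiag f r → InNewtonDiag g r → InNewtonDiag fg r
  inNewtonDiag-fg {r} (L₁ , supp₁ , weight₁≡1 , L₁≤r) (L₂ , supp₂ , weight₂≡1 , L₂≤r) =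
    L₁ ⊠ L₂ , supported-⊠ supp₁ supp₂ , weight≡1 ,
    ↑-elim {P = λ j → weightedSum (L₁ ⊠ L₂) (coord j) ≤ r} boundˣ boundʸ
    where
    weight≡1 : totalWeight (L₁ ⊠ L₂) ≡ 1ℚ
    weight≡1 = ≡.trans (weightedSum-⊠ L₁ L₂ (λ _ → 1ℚ))
                       (≡.trans (weightedSum-cong L₁ λ _ → weight₂≡1) weight₁≡1)
    boundˣ : ∀ i → weightedSum (L₁ ⊠ L₂) (coord (i ↑ˡ m)) ≤ r
    boundˣ i = ≡.subst (_≤ r) (≡.sym (≡.trans (weightedSum-⊠ L₁ L₂ (coord (i ↑ˡ m))) (weightedSum-cong L₁ λ a →
      ≡.trans (weightedSum-cong L₂ λ b → coord-++ˡ i a b) (weightedSum-const-1 L₂ (coord i a) weight₂≡1))))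
      (L₁≤r i)
    boundʸ : ∀ j → weightedSum (L₁ ⊠ L₂) (coord (n ↑ʳ j)) ≤ r
    boundʸ j = ≡.subst (_≤ r) (≡.sym (≡.trans (weightedSum-⊠ L₁ L₂ (coord (n ↑ʳ j)))
      (≡.trans (weightedSum-cong L₁ λ a → weightedSum-cong L₂ λ b → coord-++ʳ j a b)
        (weightedSum-const-1 L₁ (weightedSum L₂ (coord j)) weight₁≡1)))) (L₂≤r j)

  admissible-fgˣ : ∀ {s} → Admissible k fg s → Admissible k f s
  admissible-fgˣ = admissible-map fg f (inNewtonDiag-map₂ fg f (Vec.take n) take-coordinatewise support-fg-take)

  admissible-fgʸ : ∀ {s} → Admissible k fg s → Admissible k g s
  admissible-fgʸ = admissible-map fg g (inNewtonDiag-map₂ fg g (Vec.drop n) drop-coordinatewise support-fg-drop)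

  admissible-fg : ∀ {s} → Admissible k f s → Admissible k g s → Admissible k fg s
  admissible-fg {s} (0<s , inΔf) (_ , inΔg) =
    diag⇒admissible fg s 0<s (inNewtonDiag-fg (inNewton⇒diag f _ inΔf) (inNewton⇒diag g _ inΔg))

  admissible⁰-fg-split : ∀ s → Admissible⁰ fg s → Admissible⁰ f s × Admissible⁰ g s
  admissible⁰-fg-split s (inj₁ adm) = inj₁ (admissible-fgˣ adm) , inj₁ (admissible-fgʸ adm)
  admissible⁰-fg-split s (inj₂ s≡0) = inj₂ s≡0 , inj₂ s≡0

  admissible⁰-fg : ∀ a b → Admissible⁰ f a → Admissible⁰ g b → Admissible⁰ fg (a ⊓ b)
  admissible⁰-fg a b (inj₁ adm-f@(0<a , _)) (inj₁ adm-g@(0<b , _)) = inj₁ (admissible-fg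
    (admissible-≤ f 0<a⊓b (ℚₚ.p⊓q≤p a b) adm-f) (admissible-≤ g 0<a⊓b (ℚₚ.p⊓q≤q a b) adm-g))
    where
    0<a⊓b : 0ℚ < a ⊓ b
    0<a⊓b = [ (λ a⊓b≡a → ≡.subst (0ℚ <_) (≡.sym a⊓b≡a) 0<a) , (λ a⊓b≡b → ≡.subst (0ℚ <_) (≡.sym a⊓b≡b) 0<b) ]′
              (ℚₚ.⊓-sel a b)
  admissible⁰-fg a _ adm-f (inj₂ ≡.refl) = inj₂ (ℚₚ.p≥q⇒p⊓q≡q (admissible⁰-nonNeg f adm-f))
  admissible⁰-fg _ b (inj₂ ≡.refl) adm-g = inj₂ (ℚₚ.p≤q⇒p⊓q≡p (admissible⁰-nonNeg g adm-g))

  sigma-fg : ∀ σf σg → IsSigma k f σf → IsSigma k g σg → IsSigma k fg (min∞ σf σg)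
  sigma-fg σf σg σf-sigma σg-sigma =
    lub⇒sigma fg _ (fg-zero⊎nonZero (sigma⇒zero⊎nonZero f σf-sigma) (sigma⇒zero⊎nonZero g σg-sigma))
      (lub-⊓ (sigma⇒lub f σf σf-sigma) (sigma⇒lub g σg σg-sigma) admissible⁰-fg-split admissible⁰-fg)
    where
    open ExtendedRationals using (lub-⊓)
    open SigmaAsLub k

module Substitution {c ℓ} (k : Field c ℓ) {p} (f : Poly k (suc (suc p))) where

  open Coefficients k
  open NewtonPolyhedron k
  open WeightedExponents
  open import Data.Rational using (_≤_)
  import Data.Rational.Properties as ℚₚ

  f′ : Poly k (suc p)
  f′ = substLast k f

  mergeLast-dominates : ∀ {q} (i : Fin (suc (suc q))) →
                        Σ (Fin (suc q)) λ j → ∀ e → Vec.lookup e i ℕ.≤ Vec.lookup (mergeLast k e) j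
  mergeLast-dominates {zero} Fin.zero = Fin.zero , λ { (a ∷ b ∷ []) → ℕₚ.m≤m+n a b }
  mergeLast-dominates {zero} (Fin.suc Fin.zero) = Fin.zero , λ { (a ∷ b ∷ []) → ℕₚ.m≤n+m b a }
  mergeLast-dominates {suc q} Fin.zero = Fin.zero , λ { (a ∷ e) → ℕₚ.≤-refl }
  mergeLast-dominates {suc q} (Fin.suc i) with mergeLast-dominates i
  ... | j , i≤j = Fin.suc j , λ { (a ∷ e) → i≤j e }

  lift-supported : ∀ L′ → Supported f′ L′ →
                   ¬ ¬ Σ (Weighted (suc (suc p))) λ L → List.map (map₂ (mergeLast k)) L ≡ L′ × Supported f L
  lift-supported [] [] lifted = lifted ([] , ≡.refl , [])
  lift-supported ((l , e′) ∷ L′) ((0≤l , e′∈supp) ∷ supp) lifted =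
    support-map₂ (mergeLast k) f e′ e′∈supp λ (e , φe≡e′ , e∈supp) →
      lift-supported L′ supp λ (L , φL≡L′ , suppL) →
        lifted ((l , e) ∷ L , ≡.cong₂ _∷_ (≡.cong (l ,_) φe≡e′) φL≡L′ , (0≤l , e∈supp) ∷ suppL)

  inNewtonDiag-substLast : ∀ {r} → InNewtonDiag f′ r → ¬ ¬ InNewtonDiag f r
  inNewtonDiag-substLast {r} (L′ , supp′ , weight≡1 , L′≤r) inΔ∉ = lift-supported L′ supp′ λ where
    (L , ≡.refl , supp) → inΔ∉ (L , supp , ≡.trans (≡.sym (weightedSum-map₂ (mergeLast k) L _)) weight≡1 , λ i →
      let (j , i≤j) = mergeLast-dominates i in
      ℚₚ.≤-trans (weightedSum-mono L (All.map proj₁ supp) (λ e → fromℕ-mono-≤ (i≤j e)))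
                 (≡.subst (_≤ r) (weightedSum-map₂ (mergeLast k) L (coord j)) (L′≤r j)))

  admissible⁰-substLast : ∀ s → Admissible⁰ f′ s → ¬ ¬ Admissible⁰ f s
  admissible⁰-substLast s (inj₁ (0<s , inΔ)) adm∉ =
    inNewtonDiag-substLast (inNewton⇒diag f′ _ inΔ) λ inΔf → adm∉ (inj₁ (diag⇒admissible f s 0<s inΔf))
  admissible⁰-substLast s (inj₂ s≡0) adm∉ = adm∉ (inj₂ s≡0)

  sigma-substLast : ∀ σ₁ σ₂ → IsSigma k f σ₁ → IsSigma k f′ σ₂ → σ₂ ≤∞ σ₁
  sigma-substLast σ₁ σ₂ σ₁-sigma σ₂-sigma =
    lub-mono admissible⁰-substLast (sigma⇒lub f′ σ₂ σ₂-sigma) (sigma⇒lub f σ₁ σ₁-sigma)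
    where
    open ExtendedRationals using (lub-mono)
    open SigmaAsLub k

lemma2p1 : ∀ {c ℓ} (k : Field c ℓ) →
    (∀ (n m : ℕ) (f : Poly k n) (g : Poly k m) →
      VanishesAtOrigin k f → VanishesAtOrigin k g →
      ∀ (σf σg : ℚ∞) → IsSigma k f σf → IsSigma k g σg →
        IsSigma k (_⊕_ k (embedˣ k m f) (embedʸ k n g)) (σf +∞ σg)
        × IsSigma k (_⊗_ k (embedˣ k m f) (embedʸ k n g)) (min∞ σf σg))
  × (∀ (p : ℕ) (f : Poly k (suc (suc p))) →
      VanishesAtOrigin k f →
      ∀ (σ₁ σ₂ : ℚ∞) → IsSigma k f σ₁ → IsSigma k (substLast k f) σ₂ →
        σ₂ ≤∞ σ₁)
lemma2p1 k =
  (λ n m f g f₀≈0 g₀≈0 σf σg σf-sigma σg-sigma →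
     Sum.sigma-f+g k f g f₀≈0 g₀≈0 σf σg σf-sigma σg-sigma , Product.sigma-fg k f g σf σg σf-sigma σg-sigma) ,
  (λ p f _ σ₁ σ₂ → Substitution.sigma-substLast k f σ₁ σ₂)
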